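{- Let $n\ge 2$, $2^{n-2}<k\le 2^{n-1}$, and let $H$ be a spanned hyperplane of $Q_n$ containing at least $k$ points of $V_n$. Then the number $N_H(k)$ of partial $0/1$-equivalence classes of $H$ with $k$ vertices equals $$N_H(k)=\left[u_1^k u_2^{|V_n(H)|-k}\right]C_H(u_1,u_2).$$
   Context: $Q_n=[0,1]^n$, $V_n=\{0,1\}^n$. A $0/1$-polytope of $Q_n$ is the convex hull of a nonempty subset of $V_n$; it has $k$ vertices if that subset has $k$ elements. $B_n$ is the group of signed permutations $w$ of $\{1,\dots,n\}$ (underlying permutation $\pi$, sign $\pm$ on each $i$), acting on $\mathbb{R}^n$ by $w(x)_i=x_{\pi(i)}$ if $i$ has sign $+$ and $w(x)_i=1-x_{\pi(i)}$ if $i$ has sign $-$. A spanned hyperplane of $Q_n$ is a hyperplane $H$ such that the affine hull of $H\cap V_n$ is $H$; $V_n(H)=H\cap V_n$. Partial $0/1$-equivalence classes of $H$: $0/1$-polytopes contained in $H$, two being equivalent iff some $w\in B_n$ maps one onto the other. $F(H)=\{w\in B_n: w(H)=H\}$, which permutes $V_n(H)$. For a finite group $G$ acting on a finite set $X$ and $g\in G$, if the induced permutation of $X$ has $c_i$ cycles of length $i$, write $z^{c(g)}=\prod_i z_i^{c_i}$; the cycle index is $Z_G(z)=\frac{1}{|G|}\sum_{g\in G}z^{c(g)}$. $Z_H(z)$ is the cycle index of $F(H)$ acting on $V_n(H)$, $C_H(u_1,u_2)$ is obtained from $Z_H(z)$ by substituting $z_i\mapsto u_1^i+u_2^i$, and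 $[u_1^pu_2^q]$ denotes the coefficient of $u_1^pu_2^q$. -}

module Defs where

open import Data.Nat as ℕ using (ℕ; zero; suc; _∸_; _≡ᵇ_)
open import Data.Bool using (Bool; true; false; if_then_else_; _xor_; _∧_; not; T)
open import Data.Fin using (Fin)
open import Data.Vec as V using (Vec; []; _∷_; lookup)
open import Data.Vec.Properties using (≡-dec)
open import Data.List as L using (List; []; _∷_; length; filter; concatMap; map; upTo)
open import Data.Nat.ListAction using (sum)
open import Data.List.Relation.Unary.All using (All)
open import Data.Rational as Q using (ℚ; 0ℚ; 1ℚ)
open import Data.Rational.Properties using () renaming (_≟_ to _≟ℚ_)
open import Data.Product using (Σ; _×_; _,_; ∃)
open import Relation.Nullary using (does; ¬_)
open import Relation.Binary.PropositionalEquality using (_≡_)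
import Data.Bool.Properties as BP

Vertex : ℕ → Set
Vertex n = Vec Bool n

allVertices : (n : ℕ) → List (Vertex n)
allVertices zero    = [] ∷ []
allVertices (suc n) = concatMap (λ v → (false ∷ v) ∷ (true ∷ v) ∷ []) (allVertices n)

_==V_ : ∀ {n} → Vertex n → Vertex n → Bool
u ==V v = does (≡-dec BP._≟_ u v)

bitℚ : Bool → ℚ
bitℚ b = if b then 1ℚ else 0ℚ

emb : ∀ {n} → Vertex n → Vec ℚ n
emb = V.map bitℚ

dot : ∀ {n} → Vec ℚ n → Vec ℚ n → ℚ
dot a x = V.foldr _ Q._+_ 0ℚ (V.zipWith Q._*_ a x)

-- Hyperplanes  H = { x : a·x = b }  with rational data (a , b), a ≠ 0

record Hyp (n : ℕ) : Set where
  constructor hyp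
  field
    coef : Vec ℚ n
    rhs  : ℚ

open Hyp public

OnH : ∀ {n} → Hyp n → Vec ℚ n → Set
OnH H x = dot (coef H) x ≡ rhs H

onHᵇ : ∀ {n} → Hyp n → Vertex n → Bool
onHᵇ H v = does (dot (coef H) (emb v) ≟ℚ rhs H)

IsHyperplane : ∀ {n} → Hyp n → Set
IsHyperplane {n} H = ¬ (coef H ≡ V.replicate n 0ℚ)

VH : ∀ {n} → Hyp n → List (Vertex n)
VH {n} H = filter (λ v → onHᵇ H v ≟B true) (allVertices n)
  where open import Data.Bool.Properties using () renaming (_≟_ to _≟B_)

InAffHullVH : ∀ {n} → Hyp n → Vec ℚ n → Set
InAffHullVH {n} H x =
  Σ (List (ℚ × Vertex n)) λ cs →
    All (λ c → T (onHᵇ H (Data.Product.proj₂ c))) cs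
    × L.foldr Q._+_ 0ℚ (map Data.Product.proj₁ cs) ≡ 1ℚ
    × L.foldr (V.zipWith Q._+_) (V.replicate n 0ℚ)
        (map (λ c → V.map (Q._*_ (Data.Product.proj₁ c)) (emb (Data.Product.proj₂ c))) cs)
      ≡ x

-- spanned: the affine hull of H ∩ V_n is H  (aff(H ∩ V_n) ⊆ H always holds)
Spanned : ∀ {n} → Hyp n → Set
Spanned {n} H = IsHyperplane H × ((x : Vec ℚ n) → OnH H x → InAffHullVH H x)

-- The hyperoctahedral group B_n: signed permutations (π , s),
-- s i = true meaning that i carries the sign −.

SPerm : ℕ → Set
SPerm n = Vec (Fin n) n × Vec Bool n

IsSignedPerm : ∀ {n} → SPerm n → Set
IsSignedPerm (π , s) = ∀ i j → lookup π i ≡ lookup π j → i ≡ j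

actℚ : ∀ {n} → SPerm n → Vec ℚ n → Vec ℚ n
actℚ (π , s) x = V.tabulate λ i →
  if lookup s i then 1ℚ Q.- lookup x (lookup π i) else lookup x (lookup π i)

actV : ∀ {n} → SPerm n → Vertex n → Vertex n
actV (π , s) x = V.tabulate λ i → lookup x (lookup π i) xor lookup s i

-- w(H) = H (tested on rational points; H is rational)
Fixes : ∀ {n} → Hyp n → SPerm n → Set
Fixes H w = ∀ x → (OnH H x → OnH H (actℚ w x)) × (OnH H (actℚ w x) → OnH H x)

InF : ∀ {n} → Hyp n → SPerm n → Set
InF H w = IsSignedPerm w × Fixes H w

-- 0/1-polytopes contained in H, given by their vertex sets
-- (a subset S ⊆ V_n, as a characteristic function)

Sub : ℕ → Set
Sub n = Vertex n → Bool

card : ∀ {n} → Sub n → ℕ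
card {n} S = length (filter (λ v → S v BP.≟ true) (allVertices n))

KPolyInH : ∀ {n} → Hyp n → ℕ → Sub n → Set
KPolyInH H k S = (∀ v → S v ≡ true → T (onHᵇ H v)) × card S ≡ k

B-Equiv : ∀ {n} → Sub n → Sub n → Set
B-Equiv {n} S S' = Σ (SPerm n) λ w → IsSignedPerm w ×
  (∀ y → (S' y ≡ true → ∃ λ x → S x ≡ true × actV w x ≡ y)
       × ((∃ λ x → S x ≡ true × actV w x ≡ y) → S' y ≡ true))

-- Cycle index of F(H) acting on V_n(H), with z_i ↦ u₁^i + u₂^i.
-- Bivariate polynomials with ℕ coefficients: P p q = [u₁^p u₂^q] P.

Poly : Set
Poly = ℕ → ℕ → ℕ

sumTo : ℕ → (ℕ → ℕ) → ℕ
sumTo zero    f = f 0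
sumTo (suc m) f = sumTo m f ℕ.+ f (suc m)

oneP : Poly
oneP p q = if (p ≡ᵇ 0) ∧ (q ≡ᵇ 0) then 1 else 0

_*P_ : Poly → Poly → Poly
(P *P R) p q = sumTo p λ i → sumTo q λ j → P i j ℕ.* R (p ∸ i) (q ∸ j)

_^P_ : Poly → ℕ → Poly
P ^P zero  = oneP
P ^P suc e = P *P (P ^P e)

zP : ℕ → Poly
zP i p q = (if (p ≡ᵇ i) ∧ (q ≡ᵇ 0) then 1 else 0) ℕ.+ (if (p ≡ᵇ 0) ∧ (q ≡ᵇ i) then 1 else 0)

prodFrom1 : ℕ → (ℕ → Poly) → Poly
prodFrom1 zero    f = oneP
prodFrom1 (suc m) f = prodFrom1 m f *P f (suc m)

iter : ∀ {n} → SPerm n → ℕ → Vertex n → Vertex n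
iter g zero    x = x
iter g (suc t) x = actV g (iter g t x)

cycleLenIs : ∀ {n} → SPerm n → ℕ → Vertex n → Bool
cycleLenIs g zero    x = false
cycleLenIs g (suc j) x =
  (iter g (suc j) x ==V x) ∧ L.foldr (λ t b → not (iter g (suc t) x ==V x) ∧ b) true (upTo j)

cycles : ∀ {n} → Hyp n → SPerm n → ℕ → ℕ
cycles H g zero    = 0
cycles H g (suc j) =
  length (filter (λ x → cycleLenIs g (suc j) x BP.≟ true) (VH H)) ℕ./ suc j

cycleMonomial : ∀ {n} → Hyp n → SPerm n → Poly
cycleMonomial H g = prodFrom1 (length (VH H)) λ i → zP i ^P cycles H g i

-- |F(H)| · [u₁^p u₂^q] C_H(u₁,u₂), given a duplicate-free list Fl enumerating F(H)
scaledCoeffC : ∀ {n} → Hyp n → List (SPerm n) → ℕ → ℕ → ℕ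
scaledCoeffC H Fl p q = sum (map (λ g → cycleMonomial H g p q) Fl)

-- A nonzero linear form takes a given value on at most 2^(n-1) vertices
-- of Q_n, and two hyperplanes sharing more than 2^(n-2) vertices are proportional
-- (both by induction on n, splitting V_(n+1) along the first coordinate).  A signed
-- permutation w acts affinely, so w⁻¹(H) is again a hyperplane; if w maps a set of
-- more than 2^(n-2) vertices of H into H, then H and w⁻¹(H) coincide, i.e. w ∈ F(H).
-- Hence two k-vertex subsets of V_n(H) are B_n-equivalent iff they are
-- F(H)-equivalent.
--
-- Burnside's double count over pairs (g , σ) with g ∈ F(H), σ ⊆ V_n(H),
-- |σ| = k and gσ = σ gives |classes|·|F(H)| = Σ_g #{σ : |σ| = k, gσ = σ}.  For a
-- single g the invariant subsets are unions of g-cycles; peeling off one cycle of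
-- length t at a time (Pólya) shows that the number of invariant σ with |σ| = p and
-- |V_n(H) ∖ σ| = q is [u₁^p u₂^q] Π_i (u₁^i + u₂^i)^(c_i(g)) = cycleMonomial H g p q.
module Submission where

open import Defs
open import Data.Nat using (ℕ; zero; suc; _+_; _*_; _∸_; _^_; _≤_; _<_; _≤ᵇ_; _≡ᵇ_; _/_; z≤n; s≤s)
import Data.Nat.Properties as NP
import Data.Nat.DivMod as DM
open import Data.Nat.ListAction using (sum)
open import Data.Nat.ListAction.Properties using (sum-↭; sum-++)
open import Data.Bool using (Bool; true; false; if_then_else_; _xor_; _∧_; not; T)
import Data.Bool.Properties as BP
open import Data.Fin using (Fin; toℕ; punchOut)
import Data.Fin.Properties as FP
open import Data.Fin.Permutation using (permutation)
open import Data.Vec as V using (Vec; []; _∷_; lookup; tabulate)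
import Data.Vec.Properties as VP
open import Data.List as L using (List; []; _∷_; _++_; length; map; filter; concatMap; replicate; applyUpTo; upTo)
import Data.List.Properties as LP
open import Data.List.Membership.Propositional using (_∈_; _∉_)
import Data.List.Membership.Propositional.Properties as MP
open import Data.List.Membership.Propositional.Properties.WithK using (unique∧set⇒bag)
open import Data.List.Relation.Unary.Any as Any using (here; there)
import Data.List.Relation.Unary.Any.Properties as AnyP
open import Data.List.Relation.Unary.All as All using (All; []; _∷_)
open import Data.List.Relation.Unary.AllPairs using (AllPairs; []; _∷_)
open import Data.List.Relation.Unary.Unique.Propositional using (Unique)
import Data.List.Relation.Unary.Unique.Propositional.Properties as UP
open import Data.List.Relation.Binary.Permutation.Propositional as ↭ using (_↭_)
import Data.List.Relation.Binary.Permutation.Propositional.Properties as PP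
open import Data.List.Relation.Binary.BagAndSetEquality using (∼bag⇒↭)
open import Data.Rational as Q using (ℚ; 0ℚ; 1ℚ)
import Data.Rational.Properties as QP
open import Data.Rational.Solver using (module +-*-Solver)
open import Data.Product using (Σ; _×_; _,_; proj₁; proj₂; ∃)
open import Data.Sum using (_⊎_; inj₁; inj₂)
open import Data.Empty using (⊥; ⊥-elim)
open import Function.Bundles using (_⇔_; mk⇔; Equivalence)
open import Relation.Nullary using (¬_; ¬?; Dec; yes; no; does)
open import Relation.Nullary.Decidable using (dec-true; dec-false)
open import Relation.Binary using (tri<; tri≈; tri>)
open import Relation.Binary.PropositionalEquality
open import Algebra.Properties.CommutativeSemigroup NP.+-commutativeSemigroup using (interchange)
import Algebra.Properties.CommutativeMonoid.Sum as MonoidSum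

open +-*-Solver using (solve; _:=_; _:+_; _:*_; _:-_; :-_; con)

⟦_⟧ : Bool → ℕ
⟦ true ⟧ = 1
⟦ false ⟧ = 0

⟦∧⟧ : ∀ x y → ⟦ x ∧ y ⟧ ≡ ⟦ x ⟧ * ⟦ y ⟧
⟦∧⟧ true y = sym (NP.+-identityʳ ⟦ y ⟧)
⟦∧⟧ false y = refl

true≢false : true ≢ false
true≢false ()

bool-ext : ∀ {a b} → (a ≡ true → b ≡ true) → (b ≡ true → a ≡ true) → a ≡ b
bool-ext {false} {false} f g = refl
bool-ext {false} {true} f g = g refl
bool-ext {true} {false} f g = sym (f refl)
bool-ext {true} {true} f g = refl

∧-true : ∀ {x y} → x ∧ y ≡ true → (x ≡ true) × (y ≡ true)
∧-true {true} {true} _ = refl , refl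

does-true : ∀ {p} {P : Set p} (d : Dec P) → does d ≡ true → P
does-true (yes p) _ = p

does-⇔ : ∀ {p q} {P : Set p} {R : Set q} → (P → R) → (R → P) → (d : Dec P) (e : Dec R) → does d ≡ does e
does-⇔ f g (yes p) (yes r) = refl
does-⇔ f g (yes p) (no ¬r) = ⊥-elim (¬r (f p))
does-⇔ f g (no ¬p) (yes r) = ⊥-elim (¬p (g r))
does-⇔ f g (no ¬p) (no ¬r) = refl

beq : Bool → Bool → Bool
beq true true = true
beq false false = true
beq _ _ = false

beq-≡ : ∀ {a b} → beq a b ≡ true → a ≡ b
beq-≡ {true} {true} _ = refl
beq-≡ {false} {false} _ = refl

≡-beq : ∀ {a b} → a ≡ b → beq a b ≡ true
≡-beq {true} refl = refl
≡-beq {false} refl = refl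

≡ᵇ-refl : ∀ a → (a ≡ᵇ a) ≡ true
≡ᵇ-refl zero = refl
≡ᵇ-refl (suc a) = ≡ᵇ-refl a

≡ᵇ-≢ : ∀ {a i} → a ≢ i → (a ≡ᵇ i) ≡ false
≡ᵇ-≢ {a} {i} ne with a ≡ᵇ i in e
... | false = refl
... | true = ⊥-elim (ne (NP.≡ᵇ⇒≡ a i (subst T (sym e) _)))

≡ᵇ-≡ : ∀ {a i} → (a ≡ᵇ i) ≡ true → a ≡ i
≡ᵇ-≡ {a} {i} e = NP.≡ᵇ⇒≡ a i (subst T (sym e) _)

≤ᵇ-≤ : ∀ {i a} → i ≤ a → (i ≤ᵇ a) ≡ true
≤ᵇ-≤ {i} {a} le with i ≤ᵇ a | NP.≤⇒≤ᵇ le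
... | true | _ = refl

≤ᵇ-> : ∀ {i a} → a < i → (i ≤ᵇ a) ≡ false
≤ᵇ-> {i} {a} lt with i ≤ᵇ a in e
... | false = refl
... | true = ⊥-elim (NP.<⇒≱ lt (NP.≤ᵇ⇒≤ i a (subst T (sym e) _)))

module _ {a} {A : Set a} where

  sumL : (A → ℕ) → List A → ℕ
  sumL f xs = sum (map f xs)

  count : (A → Bool) → List A → ℕ
  count P = sumL (λ x → ⟦ P x ⟧)

  sumL-cong : ∀ {f g : A → ℕ} xs → (∀ x → x ∈ xs → f x ≡ g x) → sumL f xs ≡ sumL g xs
  sumL-cong [] h = refl
  sumL-cong (x ∷ xs) h = cong₂ _+_ (h x (here refl)) (sumL-cong xs (λ y p → h y (there p)))

  sumL-zero : ∀ {f : A → ℕ} xs → (∀ x → x ∈ xs → f x ≡ 0) → sumL f xs ≡ 0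
  sumL-zero [] h = refl
  sumL-zero (x ∷ xs) h = cong₂ _+_ (h x (here refl)) (sumL-zero xs (λ y p → h y (there p)))

  sumL-+ : ∀ (f g : A → ℕ) xs → sumL (λ x → f x + g x) xs ≡ sumL f xs + sumL g xs
  sumL-+ f g [] = refl
  sumL-+ f g (x ∷ xs) = trans (cong (f x + g x +_) (sumL-+ f g xs)) (interchange (f x) (g x) (sumL f xs) (sumL g xs))

  sumL-const : ∀ c xs → sumL (λ (_ : A) → c) xs ≡ length xs * c
  sumL-const c [] = refl
  sumL-const c (x ∷ xs) = cong (c +_) (sumL-const c xs)

  sumL-*ˡ : ∀ c (f : A → ℕ) xs → sumL (λ x → c * f x) xs ≡ c * sumL f xs
  sumL-*ˡ c f [] = sym (NP.*-zeroʳ c)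
  sumL-*ˡ c f (x ∷ xs) = trans (cong (c * f x +_) (sumL-*ˡ c f xs)) (sym (NP.*-distribˡ-+ c (f x) (sumL f xs)))

  sumL-++ : ∀ (f : A → ℕ) xs ys → sumL f (xs ++ ys) ≡ sumL f xs + sumL f ys
  sumL-++ f xs ys = trans (cong sum (LP.map-++ f xs ys)) (sum-++ (map f xs) (map f ys))

  sumL-↭ : ∀ (f : A → ℕ) {xs ys} → xs ↭ ys → sumL f xs ≡ sumL f ys
  sumL-↭ f p = sum-↭ (PP.map⁺ f p)

  count-↭ : ∀ (P : A → Bool) {xs ys} → xs ↭ ys → count P xs ≡ count P ys
  count-↭ P = sumL-↭ (λ x → ⟦ P x ⟧)

  count-++ : ∀ (P : A → Bool) xs ys → count P (xs ++ ys) ≡ count P xs + count P ys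
  count-++ P = sumL-++ (λ x → ⟦ P x ⟧)

  count-cong : ∀ {P R : A → Bool} xs → (∀ x → P x ≡ R x) → count P xs ≡ count R xs
  count-cong xs h = sumL-cong xs (λ x _ → cong ⟦_⟧ (h x))

  count-mono : ∀ {P R : A → Bool} xs → (∀ x → P x ≡ true → R x ≡ true) → count P xs ≤ count R xs
  count-mono [] h = z≤n
  count-mono (x ∷ xs) h = NP.+-mono-≤ (⟦⟧-mono (h x)) (count-mono xs h)
    where
    ⟦⟧-mono : ∀ {b c} → (b ≡ true → c ≡ true) → ⟦ b ⟧ ≤ ⟦ c ⟧
    ⟦⟧-mono {false} _ = z≤n
    ⟦⟧-mono {true} f rewrite f refl = NP.≤-refl

  count-none : ∀ {P : A → Bool} xs → (∀ x → P x ≡ true → ⊥) → count P xs ≡ 0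
  count-none {P} xs h = sumL-zero xs (λ x _ → falsy x (P x) refl)
    where
    falsy : ∀ x b → P x ≡ b → ⟦ P x ⟧ ≡ 0
    falsy x false e = cong ⟦_⟧ e
    falsy x true e = ⊥-elim (h x e)

  count-≤-length : ∀ (P : A → Bool) xs → count P xs ≤ length xs
  count-≤-length P [] = z≤n
  count-≤-length P (x ∷ xs) with P x
  ... | true = s≤s (count-≤-length P xs)
  ... | false = NP.m≤n⇒m≤1+n (count-≤-length P xs)

  count-uniform : ∀ (P : A → Bool) b xs → (∀ x → x ∈ xs → P x ≡ b) → count P xs ≡ ⟦ b ⟧ * length xs
  count-uniform P b xs h = trans (sumL-cong xs (λ x m → cong ⟦_⟧ (h x m)))
                                 (trans (sumL-const ⟦ b ⟧ xs) (NP.*-comm (length xs) ⟦ b ⟧))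

  count-∧ˡ : ∀ c (P : A → Bool) xs → count (λ x → c ∧ P x) xs ≡ ⟦ c ⟧ * count P xs
  count-∧ˡ false P xs = count-none xs (λ _ ())
  count-∧ˡ true P xs = sym (NP.+-identityʳ _)

  count+count-not : ∀ (P : A → Bool) xs → count P xs + count (λ v → not (P v)) xs ≡ length xs
  count+count-not P [] = refl
  count+count-not P (x ∷ xs) with P x
  ... | true = cong suc (count+count-not P xs)
  ... | false = trans (NP.+-suc _ _) (cong suc (count+count-not P xs))

  length-filter : ∀ (P : A → Bool) xs → length (filter (λ v → P v BP.≟ true) xs) ≡ count P xs
  length-filter P [] = refl
  length-filter P (x ∷ xs) with P x
  ... | true = cong suc (length-filter P xs)
  ... | false = length-filter P xs

  count-filter : ∀ (P R : A → Bool) xs → (∀ x → P x ≡ true → R x ≡ true) →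
                 count P xs ≡ count P (filter (λ v → R v BP.≟ true) xs)
  count-filter P R [] h = refl
  count-filter P R (x ∷ xs) h with R x in e
  ... | true = cong (⟦ P x ⟧ +_) (count-filter P R xs h)
  ... | false with P x in e'
  ...   | true = ⊥-elim (true≢false (trans (sym (h x e')) e))
  ...   | false = count-filter P R xs h

sumL-map : ∀ {a b} {A : Set a} {B : Set b} (f : B → ℕ) (g : A → B) xs → sumL f (map g xs) ≡ sumL (λ x → f (g x)) xs
sumL-map f g xs = cong sum (sym (LP.map-∘ xs))

sumL-swap : ∀ {a b} {A : Set a} {B : Set b} (f : A → B → ℕ) xs ys →
            sumL (λ x → sumL (f x) ys) xs ≡ sumL (λ y → sumL (λ x → f x y) xs) ys
sumL-swap f [] ys = sym (sumL-zero ys (λ _ _ → refl))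
sumL-swap f (x ∷ xs) ys = trans (cong (sumL (f x) ys +_) (sumL-swap f xs ys)) (sym (sumL-+ (f x) (λ y → sumL (λ x → f x y) xs) ys))

module _ {a} {A : Set a} where

  allB : (A → Bool) → List A → Bool
  allB P [] = true
  allB P (x ∷ xs) = P x ∧ allB P xs

  allB⇒ : ∀ P xs → allB P xs ≡ true → ∀ x → x ∈ xs → P x ≡ true
  allB⇒ P (y ∷ xs) e x (here refl) = proj₁ (∧-true e)
  allB⇒ P (y ∷ xs) e x (there m) = allB⇒ P xs (proj₂ (∧-true {P y} e)) x m

  ⇒allB : ∀ P xs → (∀ x → x ∈ xs → P x ≡ true) → allB P xs ≡ true
  ⇒allB P [] h = refl
  ⇒allB P (y ∷ xs) h rewrite h y (here refl) = ⇒allB P xs (λ x m → h x (there m))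

  allB-false : ∀ P xs x → x ∈ xs → P x ≡ false → allB P xs ≡ false
  allB-false P xs x m e with allB P xs in q
  ... | false = refl
  ... | true = ⊥-elim (true≢false (trans (sym (allB⇒ P xs q x m)) e))

  allB-cong : ∀ {P R} xs → (∀ x → x ∈ xs → P x ≡ R x) → allB P xs ≡ allB R xs
  allB-cong [] h = refl
  allB-cong (y ∷ xs) h = cong₂ _∧_ (h y (here refl)) (allB-cong xs (λ x m → h x (there m)))

  allB-↭ : ∀ P {xs ys} → xs ↭ ys → allB P xs ≡ allB P ys
  allB-↭ P {xs} {ys} p = bool-ext (λ e → ⇒allB P ys (λ x m → allB⇒ P xs e x (PP.∈-resp-↭ (↭.↭-sym p) m)))
                                  (λ e → ⇒allB P xs (λ x m → allB⇒ P ys e x (PP.∈-resp-↭ p m)))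

  allB-++ : ∀ P xs ys → allB P (xs ++ ys) ≡ allB P xs ∧ allB P ys
  allB-++ P [] ys = refl
  allB-++ P (x ∷ xs) ys rewrite allB-++ P xs ys = sym (BP.∧-assoc (P x) (allB P xs) (allB P ys))

  allB-filter : ∀ (P R : A → Bool) xs → (∀ x → R x ≡ false → P x ≡ true) →
                allB P xs ≡ allB P (filter (λ v → R v BP.≟ true) xs)
  allB-filter P R [] h = refl
  allB-filter P R (x ∷ xs) h with R x in e
  ... | true = cong (P x ∧_) (allB-filter P R xs h)
  ... | false rewrite h x e = allB-filter P R xs h

==V-refl : ∀ {n} (v : Vertex n) → (v ==V v) ≡ true
==V-refl v = dec-true (VP.≡-dec BP._≟_ v v) refl

==V-≡ : ∀ {n} {u v : Vertex n} → (u ==V v) ≡ true → u ≡ v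
==V-≡ {u = u} {v} = does-true (VP.≡-dec BP._≟_ u v)

==V-≢ : ∀ {n} {u v : Vertex n} → u ≢ v → (u ==V v) ≡ false
==V-≢ {u = u} {v} = dec-false (VP.≡-dec BP._≟_ u v)

allVertices-complete : ∀ {n} (v : Vertex n) → v ∈ allVertices n
allVertices-complete [] = here refl
allVertices-complete {suc n} (b ∷ v) = go b (allVertices n) (allVertices-complete v)
  where
  go : ∀ c xs → v ∈ xs → (c ∷ v) ∈ concatMap (λ u → (false ∷ u) ∷ (true ∷ u) ∷ []) xs
  go false (x ∷ xs) (here refl) = here refl
  go true (x ∷ xs) (here refl) = there (here refl)
  go c (x ∷ xs) (there p) = there (there (go c xs p))

allVertices-unique : ∀ n → Unique (allVertices n)
allVertices-unique zero = [] ∷ []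
allVertices-unique (suc n) = go (allVertices n) (allVertices-unique n)
  where
  extend : Vertex n → List (Vertex (suc n))
  extend u = (false ∷ u) ∷ (true ∷ u) ∷ []
  fresh : ∀ b x xs → All (λ y → x ≢ y) xs → All (λ y → (b ∷ x) ≢ y) (concatMap extend xs)
  fresh b x [] [] = []
  fresh b x (y ∷ ys) (ne ∷ nes) = (λ e → ne (VP.∷-injectiveʳ e)) ∷ (λ e → ne (VP.∷-injectiveʳ e)) ∷ fresh b x ys nes
  go : ∀ xs → Unique xs → Unique (concatMap extend xs)
  go [] [] = []
  go (x ∷ xs) (nx ∷ ux) = ((λ ()) ∷ fresh false x xs nx) ∷ fresh true x xs nx ∷ go xs ux

sumV-suc : ∀ n (f : Vertex (suc n) → ℕ) →
  sumL f (allVertices (suc n)) ≡ sumL (λ v → f (false ∷ v)) (allVertices n) + sumL (λ v → f (true ∷ v)) (allVertices n)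
sumV-suc n f = trans (go (allVertices n)) (sumL-+ (λ v → f (false ∷ v)) (λ v → f (true ∷ v)) (allVertices n))
  where
  go : ∀ xs → sumL f (concatMap (λ u → (false ∷ u) ∷ (true ∷ u) ∷ []) xs) ≡ sumL (λ v → f (false ∷ v) + f (true ∷ v)) xs
  go [] = refl
  go (x ∷ xs) = trans (cong (λ s → f (false ∷ x) + (f (true ∷ x) + s)) (go xs)) (sym (NP.+-assoc (f (false ∷ x)) (f (true ∷ x)) _))

length-allVertices : ∀ n → length (allVertices n) ≡ 2 ^ n
length-allVertices zero = refl
length-allVertices (suc n) = begin
  length (allVertices (suc n))           ≡⟨ sym (NP.*-identityʳ _) ⟩
  length (allVertices (suc n)) * 1       ≡⟨ sym (sumL-const 1 (allVertices (suc n))) ⟩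
  sumL (λ _ → 1) (allVertices (suc n))   ≡⟨ sumV-suc n (λ _ → 1) ⟩
  sumL (λ _ → 1) (allVertices n) + sumL (λ _ → 1) (allVertices n)
    ≡⟨ cong (λ s → s + s) (trans (sumL-const 1 (allVertices n)) (trans (NP.*-identityʳ _) (length-allVertices n))) ⟩
  2 ^ n + 2 ^ n                          ≡⟨ cong (2 ^ n +_) (sym (NP.+-identityʳ (2 ^ n))) ⟩
  2 ^ suc n ∎
  where open ≡-Reasoning

countV : ∀ n → (Vertex n → Bool) → ℕ
countV n P = count P (allVertices n)

countV-suc : ∀ n (P : Vertex (suc n) → Bool) → countV (suc n) P ≡ countV n (λ v → P (false ∷ v)) + countV n (λ v → P (true ∷ v))
countV-suc n P = sumV-suc n (λ v → ⟦ P v ⟧)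

countV-≤ : ∀ n P → countV n P ≤ 2 ^ n
countV-≤ n P = NP.≤-trans (count-≤-length P (allVertices n)) (NP.≤-reflexive (length-allVertices n))

vec-ext : ∀ {a} {A : Set a} {n} (u v : Vec A n) → (∀ i → lookup u i ≡ lookup v i) → u ≡ v
vec-ext u v h = trans (sym (VP.tabulate∘lookup u)) (trans (VP.tabulate-cong h) (VP.tabulate∘lookup v))

lookup∘tab : ∀ {a} {A : Set a} {n} (f : Fin n → A) i → lookup (tabulate f) i ≡ f i
lookup∘tab = VP.lookup∘tabulate

InjectiveVec : ∀ {n} → Vec (Fin n) n → Set
InjectiveVec π = ∀ i j → lookup π i ≡ lookup π j → i ≡ j

inj⇒surj : ∀ {n} (f : Fin n → Fin n) → (∀ i j → f i ≡ f j → i ≡ j) → ∀ j → ∃ λ i → f i ≡ j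
inj⇒surj {zero} f inj ()
inj⇒surj {suc n} f inj j with FP.any? (λ i → f i FP.≟ j)
... | yes p = p
... | no ¬p = ⊥-elim (NP.<-irrefl refl (FP.injective⇒≤ {f = h} h-inj))
  where
  miss : ∀ i → j ≢ f i
  miss i e = ¬p (i , sym e)
  h : Fin (suc n) → Fin n
  h i = punchOut (miss i)
  h-inj : ∀ {x y} → h x ≡ h y → x ≡ y
  h-inj {x} {y} e = inj x y (FP.punchOut-injective (miss x) (miss y) e)

preimage : ∀ {n} → Vec (Fin n) n → Fin n → Fin n
preimage π j with FP.any? (λ i → lookup π i FP.≟ j)
... | yes (i , _) = i
... | no _ = j

preimage-right : ∀ {n} (π : Vec (Fin n) n) → InjectiveVec π → ∀ j → lookup π (preimage π j) ≡ j
preimage-right π inj j with FP.any? (λ i → lookup π i FP.≟ j)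
... | yes (i , e) = e
... | no ¬p = ⊥-elim (¬p (inj⇒surj (lookup π) inj j))

preimage-left : ∀ {n} (π : Vec (Fin n) n) → InjectiveVec π → ∀ i → preimage π (lookup π i) ≡ i
preimage-left π inj i = inj _ _ (preimage-right π inj (lookup π i))

idS : ∀ {n} → SPerm n
idS = tabulate (λ i → i) , V.replicate _ false

-- Composition, chosen so that actV (h ⊙ g) = actV h ∘ actV g.
infixl 7 _⊙_
_⊙_ : ∀ {n} → SPerm n → SPerm n → SPerm n
(πh , sh) ⊙ (πg , sg) = tabulate (λ i → lookup πg (lookup πh i)) , tabulate (λ i → lookup sh i xor lookup sg (lookup πh i))

invS : ∀ {n} → SPerm n → SPerm n
invS (π , s) = tabulate (preimage π) , tabulate (λ j → lookup s (preimage π j))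

SPerm-ext : ∀ {n} {a b : SPerm n} → (∀ i → lookup (proj₁ a) i ≡ lookup (proj₁ b) i) →
            (∀ i → lookup (proj₂ a) i ≡ lookup (proj₂ b) i) → a ≡ b
SPerm-ext {a = π , s} {π' , s'} p q = cong₂ _,_ (vec-ext π π' p) (vec-ext s s' q)

actV-⊙ : ∀ {n} (h g : SPerm n) x → actV (h ⊙ g) x ≡ actV h (actV g x)
actV-⊙ (πh , sh) (πg , sg) x = VP.tabulate-cong pointwise
  where
  open ≡-Reasoning
  pointwise : ∀ i → lookup x (lookup (tabulate _) i) xor lookup (tabulate _) i
                  ≡ lookup (actV (πg , sg) x) (lookup πh i) xor lookup sh i
  pointwise i = begin
    lookup x (lookup (tabulate _) i) xor lookup (tabulate _) i
      ≡⟨ cong₂ _xor_ (cong (lookup x) (lookup∘tab _ i)) (lookup∘tab _ i) ⟩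
    xg xor (lookup sh i xor lookup sg (lookup πh i))
      ≡⟨ cong (xg xor_) (BP.xor-comm (lookup sh i) _) ⟩
    xg xor (lookup sg (lookup πh i) xor lookup sh i)
      ≡⟨ sym (BP.xor-assoc xg _ (lookup sh i)) ⟩
    (xg xor lookup sg (lookup πh i)) xor lookup sh i
      ≡⟨ cong (_xor lookup sh i) (sym (lookup∘tab _ (lookup πh i))) ⟩
    lookup (actV (πg , sg) x) (lookup πh i) xor lookup sh i ∎
    where
    xg = lookup x (lookup πg (lookup πh i))

actV-id : ∀ {n} x → actV (idS {n}) x ≡ x
actV-id x = vec-ext _ x λ i → trans (lookup∘tab _ i)
  (trans (cong₂ _xor_ (cong (lookup x) (lookup∘tab _ i)) (VP.lookup-replicate i false)) (BP.xor-identityʳ _))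

⊙-assoc : ∀ {n} (a b c : SPerm n) → (a ⊙ b) ⊙ c ≡ a ⊙ (b ⊙ c)
⊙-assoc (πa , sa) (πb , sb) (πc , sc) = SPerm-ext
  (λ i → trans (lookup∘tab _ i) (trans (cong (lookup πc) (lookup∘tab _ i)) (sym (trans (lookup∘tab _ i) (lookup∘tab _ (lookup πa i))))))
  (λ i → trans (lookup∘tab _ i) (trans (cong₂ _xor_ (lookup∘tab _ i) (cong (lookup sc) (lookup∘tab _ i)))
     (trans (BP.xor-assoc (lookup sa i) (lookup sb (lookup πa i)) (lookup sc (lookup πb (lookup πa i))))
       (sym (trans (lookup∘tab _ i) (cong (lookup sa i xor_) (lookup∘tab _ (lookup πa i))))))))

⊙-idʳ : ∀ {n} (a : SPerm n) → a ⊙ idS ≡ a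
⊙-idʳ (π , s) = SPerm-ext (λ i → trans (lookup∘tab _ i) (lookup∘tab _ (lookup π i)))
  (λ i → trans (lookup∘tab _ i) (trans (cong (lookup s i xor_) (VP.lookup-replicate (lookup π i) false)) (BP.xor-identityʳ _)))

⊙-invʳ : ∀ {n} (w : SPerm n) → IsSignedPerm w → w ⊙ invS w ≡ idS
⊙-invʳ (π , s) inj = SPerm-ext
  (λ i → trans (lookup∘tab _ i) (trans (lookup∘tab _ (lookup π i)) (trans (preimage-left π inj i) (sym (lookup∘tab _ i)))))
  (λ i → trans (lookup∘tab _ i) (trans (cong (lookup s i xor_) (trans (lookup∘tab _ (lookup π i)) (cong (lookup s) (preimage-left π inj i))))
           (trans (BP.xor-same (lookup s i)) (sym (VP.lookup-replicate i false)))))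

⊙-invˡ : ∀ {n} (w : SPerm n) → IsSignedPerm w → invS w ⊙ w ≡ idS
⊙-invˡ (π , s) inj = SPerm-ext
  (λ i → trans (lookup∘tab _ i) (trans (cong (lookup π) (lookup∘tab _ i)) (trans (preimage-right π inj i) (sym (lookup∘tab _ i)))))
  (λ i → trans (lookup∘tab _ i) (trans (cong₂ _xor_ (lookup∘tab _ i) (cong (lookup s) (lookup∘tab _ i)))
           (trans (BP.xor-same (lookup s (preimage π i))) (sym (VP.lookup-replicate i false)))))

⊙-signed : ∀ {n} (a b : SPerm n) → IsSignedPerm a → IsSignedPerm b → IsSignedPerm (a ⊙ b)
⊙-signed (πa , sa) (πb , sb) ia ib i j e = ia i j (ib _ _ (trans (sym (lookup∘tab _ i)) (trans e (lookup∘tab _ j))))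

invS-signed : ∀ {n} (a : SPerm n) → IsSignedPerm a → IsSignedPerm (invS a)
invS-signed (π , s) ia i j e =
  trans (sym (preimage-right π ia i)) (trans (cong (lookup π) (trans (sym (lookup∘tab _ i)) (trans e (lookup∘tab _ j)))) (preimage-right π ia j))

actV-invˡ : ∀ {n} (w : SPerm n) → IsSignedPerm w → ∀ x → actV (invS w) (actV w x) ≡ x
actV-invˡ w sw x = trans (sym (actV-⊙ (invS w) w x)) (trans (cong (λ z → actV z x) (⊙-invˡ w sw)) (actV-id x))

actV-invʳ : ∀ {n} (w : SPerm n) → IsSignedPerm w → ∀ x → actV w (actV (invS w) x) ≡ x
actV-invʳ w sw x = trans (sym (actV-⊙ w (invS w) x)) (trans (cong (λ z → actV z x) (⊙-invʳ w sw)) (actV-id x))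

actV-injective : ∀ {n} (w : SPerm n) → IsSignedPerm w → ∀ {x y : Vertex n} → actV w x ≡ actV w y → x ≡ y
actV-injective w sw {x} {y} e = trans (sym (actV-invˡ w sw x)) (trans (cong (actV (invS w)) e) (actV-invˡ w sw y))

allVertices-permuted : ∀ {n} (w : SPerm n) → IsSignedPerm w → map (actV w) (allVertices n) ↭ allVertices n
allVertices-permuted {n} w sw =
  ∼bag⇒↭ (unique∧set⇒bag (UP.map⁺ (actV-injective w sw) (allVertices-unique n)) (allVertices-unique n) (mk⇔ to from))
  where
  to : ∀ {v} → v ∈ map (actV w) (allVertices n) → v ∈ allVertices n
  to {v} _ = allVertices-complete v
  from : ∀ {v} → v ∈ allVertices n → v ∈ map (actV w) (allVertices n)
  from {v} _ = subst (_∈ map (actV w) (allVertices n)) (actV-invʳ w sw v) (MP.∈-map⁺ _ (allVertices-complete (actV (invS w) v)))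

actℚ-⊙ : ∀ {n} (h g : SPerm n) x → actℚ (h ⊙ g) x ≡ actℚ h (actℚ g x)
actℚ-⊙ (πh , sh) (πg , sg) x = VP.tabulate-cong λ i →
  trans (cong₂ (λ c z → if c then 1ℚ Q.- z else z) (lookup∘tab _ i) (cong (lookup x) (lookup∘tab _ i)))
  (sym (trans (cong (λ z → if lookup sh i then 1ℚ Q.- z else z) (lookup∘tab _ (lookup πh i)))
   (reflect-twice (lookup sh i) (lookup sg (lookup πh i)) (lookup x (lookup πg (lookup πh i))))))
  where
  reflect-twice : ∀ (a b : Bool) (y : ℚ) →
    (if a then 1ℚ Q.- (if b then 1ℚ Q.- y else y) else (if b then 1ℚ Q.- y else y)) ≡ (if (a xor b) then 1ℚ Q.- y else y)
  reflect-twice false b y = refl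
  reflect-twice true false y = refl
  reflect-twice true true y = solve 1 (λ y → con 1ℚ :- (con 1ℚ :- y) := y) refl y

actℚ-id : ∀ {n} x → actℚ (idS {n}) x ≡ x
actℚ-id x = vec-ext _ x λ i → trans (lookup∘tab _ i)
  (cong₂ (λ c z → if c then 1ℚ Q.- z else z) (VP.lookup-replicate i false) (cong (lookup x) (lookup∘tab _ i)))

actℚ-invʳ : ∀ {n} (w : SPerm n) → IsSignedPerm w → ∀ x → actℚ w (actℚ (invS w) x) ≡ x
actℚ-invʳ w sw x = trans (sym (actℚ-⊙ w (invS w) x)) (trans (cong (λ z → actℚ z x) (⊙-invʳ w sw)) (actℚ-id x))

emb-act : ∀ {n} (w : SPerm n) x → emb (actV w x) ≡ actℚ w (emb x)
emb-act (π , s) x = trans (sym (VP.tabulate-∘ bitℚ _)) (VP.tabulate-cong λ i →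
  trans (bit-xor (lookup x (lookup π i)) (lookup s i))
        (cong (λ z → if lookup s i then 1ℚ Q.- z else z) (sym (VP.lookup-map (lookup π i) bitℚ x))))
  where
  bit-xor : ∀ c s → bitℚ (c xor s) ≡ (if s then 1ℚ Q.- bitℚ c else bitℚ c)
  bit-xor false false = refl
  bit-xor false true = refl
  bit-xor true false = refl
  bit-xor true true = refl

-- Counting vertices on hyperplanes a·x = b.  Everything is by induction on n, fixing
-- the first coordinate to 0 or 1, which turns a·x = b into A·x = b or A·x = b - α.

onᵇ : ∀ {n} → Vec ℚ n → ℚ → Vertex n → Bool
onᵇ a b v = does (dot a (emb v) QP.≟ b)

onᵇ⇒ : ∀ {n} (a : Vec ℚ n) b v → onᵇ a b v ≡ true → dot a (emb v) ≡ b
onᵇ⇒ a b v = does-true (dot a (emb v) QP.≟ b)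

⇒onᵇ : ∀ {n} (a : Vec ℚ n) b v → dot a (emb v) ≡ b → onᵇ a b v ≡ true
⇒onᵇ a b v = dec-true (dot a (emb v) QP.≟ b)

onᵇ-head₀ : ∀ {n} α (A : Vec ℚ n) b v → onᵇ (α ∷ A) b (false ∷ v) ≡ onᵇ A b v
onᵇ-head₀ α A b v = does-⇔ (trans (sym (drop α _))) (trans (drop α _)) (_ QP.≟ b) (_ QP.≟ b)
  where
  drop : ∀ α d → α Q.* 0ℚ Q.+ d ≡ d
  drop = solve 2 (λ α d → α :* con 0ℚ :+ d := d) refl

onᵇ-head₁ : ∀ {n} α (A : Vec ℚ n) b v → onᵇ (α ∷ A) b (true ∷ v) ≡ onᵇ A (b Q.- α) v
onᵇ-head₁ α A b v = does-⇔ (to α (dot A (emb v)) b) (from α (dot A (emb v)) b) (_ QP.≟ b) (_ QP.≟ b Q.- α)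
  where
  to : ∀ α d b → α Q.* 1ℚ Q.+ d ≡ b → d ≡ b Q.- α
  to α d b e = trans (solve 2 (λ α d → d := (α :* con 1ℚ :+ d) :- α) refl α d) (cong (Q._- α) e)
  from : ∀ α d b → d ≡ b Q.- α → α Q.* 1ℚ Q.+ d ≡ b
  from α d b e = trans (cong (λ z → α Q.* 1ℚ Q.+ z) e) (solve 2 (λ α b → α :* con 1ℚ :+ (b :- α) := b) refl α b)

countOn-suc : ∀ m α (A : Vec ℚ m) b → countV (suc m) (onᵇ (α ∷ A) b) ≡ countV m (onᵇ A b) + countV m (onᵇ A (b Q.- α))
countOn-suc m α A b = trans (countV-suc m (onᵇ (α ∷ A) b))
  (cong₂ _+_ (count-cong (allVertices m) (onᵇ-head₀ α A b)) (count-cong (allVertices m) (onᵇ-head₁ α A b)))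

dot-zero : ∀ {n} (v : Vec ℚ n) → dot (V.replicate n 0ℚ) v ≡ 0ℚ
dot-zero [] = refl
dot-zero (x ∷ v) rewrite dot-zero v = solve 1 (λ x → con 0ℚ :* x :+ con 0ℚ := con 0ℚ) refl x

dot-scale : ∀ {n} l (A : Vec ℚ n) (v : Vec ℚ n) → dot (V.map (l Q.*_) A) v ≡ l Q.* dot A v
dot-scale l [] [] = sym (QP.*-zeroʳ l)
dot-scale l (a ∷ A) (x ∷ v) rewrite dot-scale l A v =
  solve 4 (λ l a x d → l :* a :* x :+ l :* d := l :* (a :* x :+ d)) refl l a x (dot A v)

onᵇ-zero⇒ : ∀ {n} {A : Vec ℚ n} {b} → A ≡ V.replicate n 0ℚ → ∀ v → onᵇ A b v ≡ true → 0ℚ ≡ b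
onᵇ-zero⇒ {n} {b = b} refl v e = trans (sym (dot-zero (emb v))) (onᵇ⇒ (V.replicate n 0ℚ) b v e)

≢0-head : ∀ {n} α (A : Vec ℚ n) → (α ∷ A) ≢ V.replicate (suc n) 0ℚ → A ≡ V.replicate n 0ℚ → α ≢ 0ℚ
≢0-head α A ne refl refl = ne refl

flatForm-oneHalf : ∀ {m} (A : Vec ℚ m) α c → A ≡ V.replicate m 0ℚ → α ≢ 0ℚ →
  (∀ v → onᵇ A c v ≢ true) ⊎ (∀ v → onᵇ A (c Q.- α) v ≢ true)
flatForm-oneHalf A α c A≡0 α≢0 with c QP.≟ 0ℚ
... | no c≢0 = inj₁ (λ v e → c≢0 (sym (onᵇ-zero⇒ A≡0 v e)))
... | yes refl = inj₂ (λ v e → α≢0 (trans (solve 1 (λ α → α := :- (con 0ℚ :- α)) refl α) (cong Q.-_ (sym (onᵇ-zero⇒ A≡0 v e)))))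

double-≤ : ∀ {x y k} → 2 * x ≤ k → 2 * y ≤ k → 2 * (x + y) ≤ 2 * k
double-≤ {x} {y} {k} p q = NP.≤-trans (NP.≤-reflexive (NP.*-distribˡ-+ 2 x y))
  (NP.≤-trans (NP.+-mono-≤ p q) (NP.≤-reflexive (cong (k +_) (sym (NP.+-identityʳ k)))))

atMostHalf : ∀ n (a : Vec ℚ n) b → a ≢ V.replicate n 0ℚ → 2 * countV n (onᵇ a b) ≤ 2 ^ n
atMostHalf zero [] b ne = ⊥-elim (ne refl)
atMostHalf (suc m) (α ∷ A) b ne =
  subst (λ N → 2 * N ≤ 2 ^ suc m) (sym (countOn-suc m α A b)) (halves (VP.≡-dec QP._≟_ A (V.replicate m 0ℚ)))
  where
  N₀ = countV m (onᵇ A b)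
  N₁ = countV m (onᵇ A (b Q.- α))
  halves : Dec (A ≡ V.replicate m 0ℚ) → 2 * (N₀ + N₁) ≤ 2 ^ suc m
  halves (no A≢0) = double-≤ {N₀} {N₁} (atMostHalf m A b A≢0) (atMostHalf m A (b Q.- α) A≢0)
  halves (yes A≡0) = NP.*-monoʳ-≤ 2 (oneHalf (flatForm-oneHalf A α b A≡0 (≢0-head α A ne A≡0)))
    where
    oneHalf : (∀ v → onᵇ A b v ≢ true) ⊎ (∀ v → onᵇ A (b Q.- α) v ≢ true) → N₀ + N₁ ≤ 2 ^ m
    oneHalf (inj₁ miss) = subst (λ N → N + N₁ ≤ 2 ^ m) (sym (count-none (allVertices m) miss)) (countV-≤ m (onᵇ A (b Q.- α)))
    oneHalf (inj₂ miss) = subst (λ N → N₀ + N ≤ 2 ^ m) (sym (count-none (allVertices m) miss))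
                            (subst (_≤ 2 ^ m) (sym (NP.+-identityʳ N₀)) (countV-≤ m (onᵇ A b)))

Proportional : ∀ {n} → Vec ℚ n → ℚ → Vec ℚ n → ℚ → Set
Proportional a b a' b' = Σ ℚ λ l → (a' ≡ V.map (l Q.*_) a) × (b' ≡ l Q.* b)

common : ∀ {n} → Vec ℚ n → ℚ → Vec ℚ n → ℚ → Vertex n → Bool
common a b a' b' v = onᵇ a b v ∧ onᵇ a' b' v

countCommon-suc : ∀ m α (A : Vec ℚ m) b α' A' b' →
  countV (suc m) (common (α ∷ A) b (α' ∷ A') b') ≡ countV m (common A b A' b') + countV m (common A (b Q.- α) A' (b' Q.- α'))
countCommon-suc m α A b α' A' b' = trans (countV-suc m (common (α ∷ A) b (α' ∷ A') b'))
  (cong₂ _+_ (count-cong (allVertices m) (λ v → cong₂ _∧_ (onᵇ-head₀ α A b v) (onᵇ-head₀ α' A' b' v)))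
             (count-cong (allVertices m) (λ v → cong₂ _∧_ (onᵇ-head₁ α A b v) (onᵇ-head₁ α' A' b' v))))

countCommon-none : ∀ {n} (a a' : Vec ℚ n) b b' → (∀ v → onᵇ a b v ≡ true → onᵇ a' b' v ≡ true → ⊥) → countV n (common a b a' b') ≡ 0
countCommon-none {n} a a' b b' h = count-none (allVertices n) (λ v e → h v (proj₁ (∧-true e)) (proj₂ (∧-true e)))

countCommon-≤₁ : ∀ {n} (a a' : Vec ℚ n) b b' → countV n (common a b a' b') ≤ countV n (onᵇ a b)
countCommon-≤₁ {n} a a' b b' = count-mono (allVertices n) (λ v p → proj₁ (∧-true {onᵇ a b v} p))

countCommon-≤₂ : ∀ {n} (a a' : Vec ℚ n) b b' → countV n (common a b a' b') ≤ countV n (onᵇ a' b')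
countCommon-≤₂ {n} a a' b b' = count-mono (allVertices n) (λ v p → proj₂ (∧-true {onᵇ a b v} p))

tooFew : ∀ k N c → N ≤ c → 2 * c ≤ k → 2 * k < 4 * N → ⊥
tooFew k N c p q r = NP.<-irrefl refl (NP.<-≤-trans r (NP.≤-trans (NP.*-monoʳ-≤ 4 p)
  (NP.≤-trans (NP.≤-reflexive (NP.*-assoc 2 2 c)) (NP.*-monoʳ-≤ 2 q))))

oneHalfBig : ∀ k x y → 4 * x ≤ k → 2 * k < 4 * (x + y) → k < 4 * y
oneHalfBig k x y p q with k NP.<? 4 * y
... | yes r = r
... | no ¬r = ⊥-elim (NP.<-irrefl refl (NP.<-≤-trans q (NP.≤-trans (NP.≤-reflexive (NP.*-distribˡ-+ 4 x y))
                (NP.≤-trans (NP.+-mono-≤ p (NP.≮⇒≥ ¬r)) (NP.≤-reflexive (cong (k +_) (sym (NP.+-identityʳ k))))))))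

scaledTarget : ∀ {m} l (A A' : Vec ℚ m) c c' v → A' ≡ V.map (l Q.*_) A → onᵇ A c v ≡ true → onᵇ A' c' v ≡ true → c' ≡ l Q.* c
scaledTarget l A A' c c' v eA p q =
  trans (sym (onᵇ⇒ A' c' v q)) (trans (cong (λ z → dot z (emb v)) eA) (trans (dot-scale l A (emb v)) (cong (l Q.*_) (onᵇ⇒ A c v p))))

heads-scale : ∀ l α α' b b' → b' Q.- α' ≡ l Q.* (b Q.- α) → b' ≡ l Q.* b → α' ≡ l Q.* α
heads-scale l α α' b b' e₁ e₂ = trans (solve 2 (λ α' b' → α' := b' :- (b' :- α')) refl α' b')
  (trans (cong₂ Q._-_ e₂ e₁) (solve 3 (λ l α b → l :* b :- l :* (b :- α) := l :* α) refl l α b))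

target-scale : ∀ l α α' b b' → b' Q.- α' ≡ l Q.* (b Q.- α) → α' ≡ l Q.* α → b' ≡ l Q.* b
target-scale l α α' b b' e₁ e₂ = trans (solve 2 (λ α' b' → b' := (b' :- α') :+ α') refl α' b')
  (trans (cong₂ Q._+_ e₁ e₂) (solve 3 (λ l α b → l :* (b :- α) :+ l :* α := l :* b) refl l α b))

-- Inductive step of rigidity when the tail A of the first form is nonzero: the larger
-- half is proportional by induction, and then so is the whole, since otherwise the
-- other half would be empty and the common vertices would fit in a hyperplane of Q_m.
rigidity-step : ∀ m α α' (A A' : Vec ℚ m) b b' → A ≢ V.replicate m 0ℚ →
  (∀ c c' → 2 ^ m < 4 * countV m (common A c A' c') → Proportional A c A' c') →
  2 * 2 ^ m < 4 * (countV m (common A b A' b') + countV m (common A (b Q.- α) A' (b' Q.- α'))) →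
  Proportional (α ∷ A) b (α' ∷ A') b'
rigidity-step m α α' A A' b b' A≢0 ih big = largerHalf (2 ^ m NP.<? 4 * N₀)
  where
  N₀ = countV m (common A b A' b')
  N₁ = countV m (common A (b Q.- α) A' (b' Q.- α'))
  fromHalf₀ : Proportional A b A' b' → Proportional (α ∷ A) b (α' ∷ A') b'
  fromHalf₀ (l , eA , eb) with α' QP.≟ l Q.* α
  ... | yes eα = l , cong₂ _∷_ eα eA , eb
  ... | no neα = ⊥-elim (tooFew (2 ^ m) (N₀ + N₁) (countV m (onᵇ A b))
          (subst (λ N → N₀ + N ≤ countV m (onᵇ A b)) (sym N₁≡0)
                 (subst (_≤ countV m (onᵇ A b)) (sym (NP.+-identityʳ N₀)) (countCommon-≤₁ A A' b b')))
          (atMostHalf m A b A≢0) big)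
    where
    N₁≡0 : N₁ ≡ 0
    N₁≡0 = countCommon-none A A' (b Q.- α) (b' Q.- α') λ v p q →
      neα (heads-scale l α α' b b' (scaledTarget l A A' (b Q.- α) (b' Q.- α') v eA p q) eb)
  fromHalf₁ : Proportional A (b Q.- α) A' (b' Q.- α') → Proportional (α ∷ A) b (α' ∷ A') b'
  fromHalf₁ (l , eA , eb) with α' QP.≟ l Q.* α
  ... | yes eα = l , cong₂ _∷_ eα eA , target-scale l α α' b b' eb eα
  ... | no neα = ⊥-elim (tooFew (2 ^ m) (N₀ + N₁) (countV m (onᵇ A (b Q.- α)))
          (subst (λ N → N + N₁ ≤ countV m (onᵇ A (b Q.- α))) (sym N₀≡0) (countCommon-≤₁ A A' (b Q.- α) (b' Q.- α')))
          (atMostHalf m A (b Q.- α) A≢0) big)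
    where
    N₀≡0 : N₀ ≡ 0
    N₀≡0 = countCommon-none A A' b b' λ v p q →
      neα (heads-scale l α α' b b' eb (scaledTarget l A A' b b' v eA p q))
  largerHalf : Dec (2 ^ m < 4 * N₀) → Proportional (α ∷ A) b (α' ∷ A') b'
  largerHalf (yes big₀) = fromHalf₀ (ih b b' big₀)
  largerHalf (no ¬big₀) = fromHalf₁ (ih (b Q.- α) (b' Q.- α') (oneHalfBig (2 ^ m) N₀ N₁ (NP.≮⇒≥ ¬big₀) big))

-- Inductive step when the first form is (α , 0, …, 0): all common vertices lie in one
-- half.  If A' ≠ 0 they are too few; if A' = 0 both forms are multiples of x₁ and any
-- common vertex pins down the right-hand sides.
rigidity-flat : ∀ m α α' (A A' : Vec ℚ m) b b' → A ≡ V.replicate m 0ℚ → α ≢ 0ℚ →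
  2 * 2 ^ m < 4 * (countV m (common A b A' b') + countV m (common A (b Q.- α) A' (b' Q.- α'))) →
  Proportional (α ∷ A) b (α' ∷ A') b'
rigidity-flat m α α' A A' b b' A≡0 α≢0 big = byTail (VP.≡-dec QP._≟_ A' (V.replicate m 0ℚ))
  where
  N₀ = countV m (common A b A' b')
  N₁ = countV m (common A (b Q.- α) A' (b' Q.- α'))
  tooMany : (∀ v → onᵇ A b v ≢ true) ⊎ (∀ v → onᵇ A (b Q.- α) v ≢ true) → A' ≢ V.replicate m 0ℚ → ⊥
  tooMany (inj₁ miss) A'≢0 = tooFew (2 ^ m) (N₀ + N₁) (countV m (onᵇ A' (b' Q.- α')))
    (subst (λ N → N + N₁ ≤ countV m (onᵇ A' (b' Q.- α'))) (sym (countCommon-none A A' b b' (λ v p _ → miss v p)))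
           (countCommon-≤₂ A A' (b Q.- α) (b' Q.- α')))
    (atMostHalf m A' (b' Q.- α') A'≢0) big
  tooMany (inj₂ miss) A'≢0 = tooFew (2 ^ m) (N₀ + N₁) (countV m (onᵇ A' b'))
    (subst (λ N → N₀ + N ≤ countV m (onᵇ A' b')) (sym (countCommon-none A A' (b Q.- α) (b' Q.- α') (λ v p _ → miss v p)))
           (subst (_≤ countV m (onᵇ A' b')) (sym (NP.+-identityʳ N₀)) (countCommon-≤₂ A A' b b')))
    (atMostHalf m A' b' A'≢0) big
  byTail : Dec (A' ≡ V.replicate m 0ℚ) → Proportional (α ∷ A) b (α' ∷ A') b'
  byTail (no A'≢0) = ⊥-elim (tooMany (flatForm-oneHalf A α b A≡0 α≢0) A'≢0)
  byTail (yes A'≡0) = l , cong₂ _∷_ (sym lα≡α') (trans A'≡0 (trans (zeros m) (cong (V.map (l Q.*_)) (sym A≡0)))) ,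
                      target (b' QP.≟ l Q.* b)
    where
    instance _ = Q.≢-nonZero α≢0
    l = α' Q.÷ α
    lα≡α' : l Q.* α ≡ α'
    lα≡α' = trans (QP.*-assoc α' (Q.1/ α) α) (trans (cong (α' Q.*_) (QP.*-inverseˡ α)) (QP.*-identityʳ α'))
    zeros : ∀ k → V.replicate k 0ℚ ≡ V.map (l Q.*_) (V.replicate k 0ℚ)
    zeros zero = refl
    zeros (suc k) = cong₂ _∷_ (sym (QP.*-zeroʳ l)) (zeros k)
    sub≡0 : ∀ x y → 0ℚ ≡ x Q.- y → x ≡ y
    sub≡0 x y e = trans (solve 2 (λ x y → x := (x :- y) :+ y) refl x y) (trans (cong (Q._+ y) (sym e)) (QP.+-identityˡ y))
    target : Dec (b' ≡ l Q.* b) → b' ≡ l Q.* b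
    target (yes e) = e
    target (no ne) = ⊥-elim (NP.n≮0 (subst (λ z → 2 * 2 ^ m < 4 * z) (cong₂ _+_ N₀≡0 N₁≡0) big))
      where
      N₀≡0 : N₀ ≡ 0
      N₀≡0 = countCommon-none A A' b b' λ v p q →
        ne (trans (sym (onᵇ-zero⇒ A'≡0 v q)) (trans (sym (QP.*-zeroʳ l)) (cong (l Q.*_) (onᵇ-zero⇒ A≡0 v p))))
      N₁≡0 : N₁ ≡ 0
      N₁≡0 = countCommon-none A A' (b Q.- α) (b' Q.- α') λ v p q →
        ne (trans (sub≡0 b' α' (onᵇ-zero⇒ A'≡0 v q)) (trans (sym lα≡α') (cong (l Q.*_) (sym (sub≡0 b α (onᵇ-zero⇒ A≡0 v p))))))

rigidity : ∀ n (a a' : Vec ℚ n) b b' → a ≢ V.replicate n 0ℚ →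
           2 ^ n < 4 * countV n (common a b a' b') → Proportional a b a' b'
rigidity zero [] [] b b' ne _ = ⊥-elim (ne refl)
rigidity (suc m) (α ∷ A) (α' ∷ A') b b' ne big = byTail (VP.≡-dec QP._≟_ A (V.replicate m 0ℚ))
  where
  big' : 2 * 2 ^ m < 4 * (countV m (common A b A' b') + countV m (common A (b Q.- α) A' (b' Q.- α')))
  big' = subst (λ z → 2 * 2 ^ m < 4 * z) (countCommon-suc m α A b α' A' b') big
  byTail : Dec (A ≡ V.replicate m 0ℚ) → Proportional (α ∷ A) b (α' ∷ A') b'
  byTail (yes A≡0) = rigidity-flat m α α' A A' b b' A≡0 (≢0-head α A ne A≡0) big'
  byTail (no A≢0) = rigidity-step m α α' A A' b b' A≢0 (λ c c' → rigidity m A A' c c' A≢0) big'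

module Σℚ = MonoidSum QP.+-0-commutativeMonoid

-- dot as a Fin-indexed sum, so that it can be reindexed along π.
dot-sum : ∀ {n} (a x : Vec ℚ n) → dot a x ≡ Σℚ.sum (λ i → lookup a i Q.* lookup x i)
dot-sum [] [] = refl
dot-sum (a ∷ as) (x ∷ xs) = cong (a Q.* x Q.+_) (dot-sum as xs)

signedCoef : ∀ {n} → Vec ℚ n → SPerm n → Fin n → ℚ
signedCoef a (π , s) i = if lookup s i then Q.- lookup a i else lookup a i

pullback : ∀ {n} → Vec ℚ n → SPerm n → Vec ℚ n
pullback a (π , s) = tabulate (λ j → signedCoef a (π , s) (preimage π j))

offset : ∀ {n} → Vec ℚ n → SPerm n → ℚ
offset a (π , s) = Σℚ.sum (λ i → if lookup s i then lookup a i else 0ℚ)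

dot-actℚ : ∀ {n} (a : Vec ℚ n) (w : SPerm n) → IsSignedPerm w → ∀ x → dot a (actℚ w x) ≡ dot (pullback a w) x Q.+ offset a w
dot-actℚ {n} a (π , s) inj x = begin
  dot a (actℚ (π , s) x)
    ≡⟨ dot-sum a _ ⟩
  Σℚ.sum (λ i → lookup a i Q.* lookup (actℚ (π , s) x) i)
    ≡⟨ Σℚ.sum-cong-≗ (λ i → trans (cong (lookup a i Q.*_) (lookup∘tab _ i)) (coordinate (lookup s i) (lookup a i) (lookup x (lookup π i)))) ⟩
  Σℚ.sum (λ i → signedCoef a (π , s) i Q.* lookup x (lookup π i) Q.+ (if lookup s i then lookup a i else 0ℚ))
    ≡⟨ Σℚ.∑-distrib-+ (λ i → signedCoef a (π , s) i Q.* lookup x (lookup π i)) _ ⟩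
  Σℚ.sum (λ i → signedCoef a (π , s) i Q.* lookup x (lookup π i)) Q.+ offset a (π , s)
    ≡⟨ cong (Q._+ offset a (π , s)) (sym reindex) ⟩
  dot (pullback a (π , s)) x Q.+ offset a (π , s) ∎
  where
  open ≡-Reasoning
  coordinate : ∀ s (a y : ℚ) → a Q.* (if s then 1ℚ Q.- y else y) ≡ (if s then Q.- a else a) Q.* y Q.+ (if s then a else 0ℚ)
  coordinate false a y = solve 2 (λ a y → a :* y := a :* y :+ con 0ℚ) refl a y
  coordinate true a y = solve 2 (λ a y → a :* (con 1ℚ :- y) := (:- a) :* y :+ a) refl a y
  -- substituting j = π i in the sum defining the pullback
  reindex : dot (pullback a (π , s)) x ≡ Σℚ.sum (λ i → signedCoef a (π , s) i Q.* lookup x (lookup π i))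
  reindex = trans (dot-sum (pullback a (π , s)) x)
    (trans (Σℚ.∑-permute (λ j → lookup (pullback a (π , s)) j Q.* lookup x j)
                         (permutation (lookup π) (preimage π) (preimage-right π inj) (preimage-left π inj)))
      (Σℚ.sum-cong-≗ λ i → cong (Q._* lookup x (lookup π i))
        (trans (lookup∘tab _ (lookup π i)) (cong (signedCoef a (π , s)) (preimage-left π inj i)))))

-- The entries of the pullback are ±a_i in another order, so it is nonzero with a.
pullback-nonzero : ∀ {n} (a : Vec ℚ n) (w : SPerm n) → IsSignedPerm w → a ≢ V.replicate n 0ℚ → pullback a w ≢ V.replicate n 0ℚ
pullback-nonzero {n} a (π , s) inj ne e = ne (vec-ext a _ λ i → trans (unsign i (lookup s i) refl) (sym (VP.lookup-replicate i 0ℚ)))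
  where
  signed≡0 : ∀ i → signedCoef a (π , s) i ≡ 0ℚ
  signed≡0 i = trans (sym (cong (signedCoef a (π , s)) (preimage-left π inj i)))
    (trans (sym (lookup∘tab _ (lookup π i))) (trans (cong (λ z → lookup z (lookup π i)) e) (VP.lookup-replicate (lookup π i) 0ℚ)))
  unsign : ∀ i c → c ≡ lookup s i → lookup a i ≡ 0ℚ
  unsign i false eq = trans (cong (λ z → if z then Q.- lookup a i else lookup a i) eq) (signed≡0 i)
  unsign i true eq = trans (solve 1 (λ y → y := :- (:- y)) refl (lookup a i))
    (cong Q.-_ (trans (cong (λ z → if z then Q.- lookup a i else lookup a i) eq) (signed≡0 i)))

*-cancelˡ : ∀ l u v → l ≢ 0ℚ → l Q.* u ≡ l Q.* v → u ≡ v
*-cancelˡ l u v l≢0 e = trans (undo u) (trans (cong (Q._* l⁻¹) e) (sym (undo v)))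
  where
  instance _ = Q.≢-nonZero l≢0
  l⁻¹ = Q.1/ l
  undo : ∀ u → u ≡ l Q.* u Q.* l⁻¹
  undo u = trans (sym (QP.*-identityʳ u)) (trans (cong (u Q.*_) (sym (QP.*-inverseʳ l)))
                 (solve 3 (λ u l t → u :* (l :* t) := l :* u :* t) refl u l l⁻¹))

-- If w maps a set σ of more than 2^(n-2) vertices of H into H, then w(H) = H:
-- H and w⁻¹(H) share σ, so by rigidity they are proportional, hence equal.
stabilises : ∀ {n} (H : Hyp n) → IsHyperplane H → (w : SPerm n) → IsSignedPerm w → (σ : Sub n) →
             2 ^ n < 4 * countV n σ → (∀ x → σ x ≡ true → (onHᵇ H x ≡ true) × (onHᵇ H (actV w x) ≡ true)) → Fixes H w
stabilises {n} H H≢0 w sw σ big σ⊆H = λ y → forward y , backward y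
  where
  a = coef H
  b = rhs H
  a' = pullback a w
  c = offset a w
  move : ∀ y c b → y Q.+ c ≡ b → y ≡ b Q.- c
  move y c b e = trans (solve 2 (λ y c → y := (y :+ c) :- c) refl y c) (cong (Q._- c) e)
  σ⊆both : ∀ x → σ x ≡ true → common a b a' (b Q.- c) x ≡ true
  σ⊆both x p = cong₂ _∧_ (proj₁ (σ⊆H x p)) (⇒onᵇ a' (b Q.- c) x (move (dot a' (emb x)) c b
    (trans (sym (dot-actℚ a w sw (emb x))) (trans (cong (dot a) (sym (emb-act w x))) (onᵇ⇒ a b (actV w x) (proj₂ (σ⊆H x p)))))))
  proportional : Proportional a b a' (b Q.- c)
  proportional = rigidity n a a' b (b Q.- c) H≢0 (NP.<-≤-trans big (NP.*-monoʳ-≤ 4 (count-mono (allVertices n) σ⊆both)))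
  l = proj₁ proportional
  a'≡la = proj₁ (proj₂ proportional)
  b-c≡lb = proj₂ (proj₂ proportional)
  image : ∀ y → dot a (actℚ w y) ≡ l Q.* dot a y Q.+ c
  image y = trans (dot-actℚ a w sw y) (cong (Q._+ c) (trans (cong (λ z → dot z y) a'≡la) (dot-scale l a y)))
  l≢0 : l ≢ 0ℚ
  l≢0 e = pullback-nonzero a w sw H≢0 (trans a'≡la (trans (cong (λ z → V.map (z Q.*_) a) e) (zeroScale a)))
    where
    zeroScale : ∀ {k} (v : Vec ℚ k) → V.map (0ℚ Q.*_) v ≡ V.replicate k 0ℚ
    zeroScale [] = refl
    zeroScale (x ∷ v) = cong₂ _∷_ (QP.*-zeroˡ x) (zeroScale v)
  forward : ∀ y → OnH H y → OnH H (actℚ w y)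
  forward y e = trans (image y) (trans (cong (λ z → l Q.* z Q.+ c) e)
    (trans (cong (Q._+ c) (sym b-c≡lb)) (solve 2 (λ b c → b :- c :+ c := b) refl b c)))
  backward : ∀ y → OnH H (actℚ w y) → OnH H y
  backward y e = *-cancelˡ l (dot a y) b l≢0 (trans (move _ c b (trans (sym (image y)) e)) b-c≡lb)

module _ {n : ℕ} where

  assign : Vertex n → Bool → Sub n → Sub n
  assign y c σ v = if v ==V y then c else σ v

  bothValues : Vertex n → (Sub n → ℕ) → Sub n → ℕ
  bothValues y f τ = f (assign y false τ) + f (assign y true τ)

  -- Σ f τ over the 2^|Y| subsets τ obtained from σ by reassigning its values on Y.
  sumOver : List (Vertex n) → (Sub n → ℕ) → Sub n → ℕ
  sumOver [] f σ = f σ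
  sumOver (y ∷ Y) f σ = sumOver Y (bothValues y f) σ

  sumSubsets : List (Vertex n) → (Sub n → ℕ) → ℕ
  sumSubsets Y f = sumOver Y f (λ _ → false)

  assign-here : ∀ y c σ → assign y c σ y ≡ c
  assign-here y c σ rewrite ==V-refl y = refl

  assign-there : ∀ y c σ v → v ≢ y → assign y c σ v ≡ σ v
  assign-there y c σ v ne rewrite ==V-≢ ne = refl

  assign-cong : ∀ y c {τ τ'} → (∀ v → τ v ≡ τ' v) → ∀ v → assign y c τ v ≡ assign y c τ' v
  assign-cong y c h v with v ==V y
  ... | true = refl
  ... | false = h v

  assign-comm : ∀ x y a b τ → x ≢ y → ∀ v → assign x a (assign y b τ) v ≡ assign y b (assign x a τ) v
  assign-comm x y a b τ ne v with v ==V x in e₁ | v ==V y in e₂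
  ... | true | true = ⊥-elim (ne (trans (sym (==V-≡ {u = v} e₁)) (==V-≡ {u = v} e₂)))
  ... | true | false = refl
  ... | false | true = refl
  ... | false | false = refl

  sumOver-cong : ∀ Y {f g : Sub n → ℕ} → (∀ τ → f τ ≡ g τ) → ∀ σ → sumOver Y f σ ≡ sumOver Y g σ
  sumOver-cong [] h σ = h σ
  sumOver-cong (y ∷ Y) h σ = sumOver-cong Y (λ τ → cong₂ _+_ (h _) (h _)) σ

  sumOver-+ : ∀ Y (f g : Sub n → ℕ) σ → sumOver Y (λ τ → f τ + g τ) σ ≡ sumOver Y f σ + sumOver Y g σ
  sumOver-+ [] f g σ = refl
  sumOver-+ (y ∷ Y) f g σ =
    trans (sumOver-cong Y (λ τ → interchange (f (assign y false τ)) (g (assign y false τ)) (f (assign y true τ)) (g (assign y true τ))) σ)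
          (sumOver-+ Y (bothValues y f) (bothValues y g) σ)

  sumOver-zero : ∀ Y σ → sumOver Y (λ _ → 0) σ ≡ 0
  sumOver-zero [] σ = refl
  sumOver-zero (y ∷ Y) σ = sumOver-zero Y σ

  sumOver-*ˡ : ∀ Y k (f : Sub n → ℕ) σ → sumOver Y (λ τ → k * f τ) σ ≡ k * sumOver Y f σ
  sumOver-*ˡ [] k f σ = refl
  sumOver-*ˡ (y ∷ Y) k f σ = trans (sumOver-cong Y (λ τ → sym (NP.*-distribˡ-+ k (f (assign y false τ)) (f (assign y true τ)))) σ)
                                   (sumOver-*ˡ Y k (bothValues y f) σ)

  sumOver-sumL : ∀ {a} {A : Set a} Y (F : A → Sub n → ℕ) xs σ →
                 sumOver Y (λ τ → sumL (λ g → F g τ) xs) σ ≡ sumL (λ g → sumOver Y (F g) σ) xs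
  sumOver-sumL Y F [] σ = sumOver-zero Y σ
  sumOver-sumL Y F (x ∷ xs) σ = trans (sumOver-+ Y (F x) (λ τ → sumL (λ g → F g τ) xs) σ)
                                      (cong (sumOver Y (F x) σ +_) (sumOver-sumL Y F xs σ))

  sumOver-++ : ∀ D W f σ → sumOver (D ++ W) f σ ≡ sumOver W (sumOver D f) σ
  sumOver-++ [] W f σ = refl
  sumOver-++ (d ∷ D) W f σ = sumOver-++ D W (bothValues d f) σ

  Extensional : (Sub n → ℕ) → Set
  Extensional f = ∀ τ τ' → (∀ v → τ v ≡ τ' v) → f τ ≡ f τ'

  bothValues-ext : ∀ y f → Extensional f → Extensional (bothValues y f)
  bothValues-ext y f e τ τ' h = cong₂ _+_ (e _ _ (assign-cong y false h)) (e _ _ (assign-cong y true h))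

  sumOver-ext : ∀ Y f → Extensional f → Extensional (sumOver Y f)
  sumOver-ext [] f e = e
  sumOver-ext (y ∷ Y) f e = sumOver-ext Y (bothValues y f) (bothValues-ext y f e)

  bothValues-swap : ∀ x y f → Extensional f → ∀ τ → bothValues y (bothValues x f) τ ≡ bothValues x (bothValues y f) τ
  bothValues-swap x y f e τ with VP.≡-dec BP._≟_ x y
  ... | yes refl = refl
  ... | no x≢y = trans (cong₂ _+_ (cong₂ _+_ (c false false) (c true false)) (cong₂ _+_ (c false true) (c true true)))
                       (interchange (f (assign y false (assign x false τ))) (f (assign y false (assign x true τ)))
                                    (f (assign y true (assign x false τ))) (f (assign y true (assign x true τ))))
    where
    c : ∀ a b → f (assign x a (assign y b τ)) ≡ f (assign y b (assign x a τ))
    c a b = e _ _ (assign-comm x y a b τ x≢y)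

  sumOver-↭ : ∀ {Y Y'} → Y ↭ Y' → ∀ f → Extensional f → ∀ σ → sumOver Y f σ ≡ sumOver Y' f σ
  sumOver-↭ ↭.refl f e σ = refl
  sumOver-↭ (↭.prep x p) f e σ = sumOver-↭ p (bothValues x f) (bothValues-ext x f e) σ
  sumOver-↭ (↭.trans p q) f e σ = trans (sumOver-↭ p f e σ) (sumOver-↭ q f e σ)
  sumOver-↭ {x ∷ y ∷ Y} (↭.swap x y p) f e σ =
    trans (sumOver-cong Y (bothValues-swap x y f e) σ)
          (sumOver-↭ p _ (bothValues-ext x (bothValues y f) (bothValues-ext y f e)) σ)

  SupportedIn : List (Vertex n) → Sub n → Set
  SupportedIn W τ = ∀ v → v ∉ W → τ v ≡ false

  assign-supported : ∀ y Y c τ → SupportedIn Y τ → SupportedIn (y ∷ Y) (assign y c τ)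
  assign-supported y Y c τ s v v∉ = trans (assign-there y c τ v (λ e → v∉ (here e))) (s v (λ m → v∉ (there m)))

  sumOver-congSupported : ∀ Y W (f g : Sub n → ℕ) σ → SupportedIn W σ →
                          (∀ τ → SupportedIn (Y ++ W) τ → f τ ≡ g τ) → sumOver Y f σ ≡ sumOver Y g σ
  sumOver-congSupported [] W f g σ s h = h σ s
  sumOver-congSupported (y ∷ Y) W f g σ s h = sumOver-congSupported Y W _ _ σ s λ τ sτ →
    cong₂ _+_ (h _ (assign-supported y (Y ++ W) false τ sτ)) (h _ (assign-supported y (Y ++ W) true τ sτ))

  sumSubsets-cong : ∀ Y (f g : Sub n → ℕ) → (∀ τ → SupportedIn Y τ → f τ ≡ g τ) → sumSubsets Y f ≡ sumSubsets Y g
  sumSubsets-cong Y f g h = sumOver-congSupported Y [] f g (λ _ → false) (λ _ _ → refl)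
    (λ τ s → h τ (λ v v∉ → s v (λ m → v∉ (subst (v ∈_) (LP.++-identityʳ Y) m))))

  agreesOn : List (Vertex n) → Sub n → Sub n → Bool
  agreesOn D τ T = allB (λ d → beq (τ d) (T d)) D

  agreesOn-assign : ∀ D d c τ T → All (λ y → d ≢ y) D → agreesOn D (assign d c τ) T ≡ agreesOn D τ T
  agreesOn-assign [] d c τ T [] = refl
  agreesOn-assign (y ∷ D) d c τ T (ne ∷ nes) =
    cong₂ _∧_ (cong (λ z → beq z (T y)) (assign-there d c τ y (λ e → ne (sym e)))) (agreesOn-assign D d c τ T nes)

  -- Exactly one reassignment of σ on D agrees with T there; so for G insensitive to
  -- the values on D, summing [τ agrees with T on D] · G τ gives G σ.
  sumOver-pin : ∀ D (T : Sub n) (G : Sub n → ℕ) → Unique D → (∀ d → d ∈ D → ∀ c τ → G (assign d c τ) ≡ G τ) →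
                ∀ σ → sumOver D (λ τ → ⟦ agreesOn D τ T ⟧ * G τ) σ ≡ G σ
  sumOver-pin [] T G u insensitive σ = NP.+-identityʳ (G σ)
  sumOver-pin (d ∷ D) T G (d∉D ∷ u) insensitive σ =
    trans (sumOver-cong D (λ τ → trans (cong₂ _+_ (peel false τ) (peel true τ)) (oneValue (T d) (agreesOn D τ T) (G τ))) σ)
          (sumOver-pin D T G u (λ d' m → insensitive d' (there m)) σ)
    where
    peel : ∀ c τ → ⟦ agreesOn (d ∷ D) (assign d c τ) T ⟧ * G (assign d c τ) ≡ ⟦ beq c (T d) ∧ agreesOn D τ T ⟧ * G τ
    peel c τ = cong₂ (λ a b → ⟦ a ⟧ * b)
      (cong₂ _∧_ (cong (λ z → beq z (T d)) (assign-here d c τ)) (agreesOn-assign D d c τ T d∉D)) (insensitive d (here refl) c τ)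
    oneValue : ∀ t A g → ⟦ beq false t ∧ A ⟧ * g + ⟦ beq true t ∧ A ⟧ * g ≡ ⟦ A ⟧ * g
    oneValue false A g = NP.+-identityʳ _
    oneValue true A g = refl

-- Multiplying by z_i shifts one of
-- the two exponents by i (timesZ); a product of z_i's is therefore determined by the
-- multiset of the indices i (zProduct), which is how Pólya's count is matched below.

if10 : ∀ b → (if b then 1 else 0) ≡ ⟦ b ⟧
if10 true = refl
if10 false = refl

sumTo-cong : ∀ m {f g : ℕ → ℕ} → (∀ a → f a ≡ g a) → sumTo m f ≡ sumTo m g
sumTo-cong zero h = h 0
sumTo-cong (suc m) h = cong₂ _+_ (sumTo-cong m h) (h (suc m))

sumTo-zero : ∀ m {f : ℕ → ℕ} → (∀ a → a ≤ m → f a ≡ 0) → sumTo m f ≡ 0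
sumTo-zero zero h = h 0 z≤n
sumTo-zero (suc m) h = cong₂ _+_ (sumTo-zero m (λ a le → h a (NP.m≤n⇒m≤1+n le))) (h (suc m) NP.≤-refl)

sumTo-+ : ∀ m (f g : ℕ → ℕ) → sumTo m (λ a → f a + g a) ≡ sumTo m f + sumTo m g
sumTo-+ zero f g = refl
sumTo-+ (suc m) f g = trans (cong (_+ (f (suc m) + g (suc m))) (sumTo-+ m f g))
                            (interchange (sumTo m f) (sumTo m g) (f (suc m)) (g (suc m)))

sumTo-*ˡ : ∀ m k (f : ℕ → ℕ) → sumTo m (λ a → k * f a) ≡ k * sumTo m f
sumTo-*ˡ zero k f = refl
sumTo-*ˡ (suc m) k f = trans (cong (_+ k * f (suc m)) (sumTo-*ˡ m k f)) (sym (NP.*-distribˡ-+ k (sumTo m f) (f (suc m))))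

sumTo-delta : ∀ m i (F : ℕ → ℕ) → sumTo m (λ a → ⟦ a ≡ᵇ i ⟧ * F a) ≡ ⟦ i ≤ᵇ m ⟧ * F i
sumTo-delta zero zero F = refl
sumTo-delta zero (suc i) F = refl
sumTo-delta (suc m) i F with i NP.≤? m
... | yes i≤m = trans (cong₂ _+_ (sumTo-delta m i F) (cong (λ z → ⟦ z ⟧ * F (suc m)) (≡ᵇ-≢ (λ e → NP.<-irrefl (sym e) (s≤s i≤m)))))
                (trans (NP.+-identityʳ _) (cong (λ z → ⟦ z ⟧ * F i) (trans (≤ᵇ-≤ i≤m) (sym (≤ᵇ-≤ (NP.m≤n⇒m≤1+n i≤m))))))
... | no i≰m with i NP.≟ suc m
...   | yes refl = trans (cong₂ _+_ (sumTo-delta m (suc m) F) (cong (λ z → ⟦ z ⟧ * F (suc m)) (≡ᵇ-refl m)))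
                     (trans (cong (λ z → ⟦ z ⟧ * F (suc m) + (F (suc m) + 0)) (≤ᵇ-> (NP.n<1+n m)))
                            (cong (λ z → ⟦ z ⟧ * F (suc m)) (sym (≤ᵇ-≤ (NP.≤-refl {suc m})))))
...   | no i≢ = trans (cong₂ _+_ (sumTo-delta m i F) (cong (λ z → ⟦ z ⟧ * F (suc m)) (≡ᵇ-≢ (λ e → i≢ (sym e)))))
                  (trans (cong (λ z → ⟦ z ⟧ * F i + 0) (≤ᵇ-> (NP.≰⇒> i≰m)))
                         (cong (λ z → ⟦ z ⟧ * F i) (sym (≤ᵇ-> (NP.≤∧≢⇒< (NP.≰⇒> i≰m) (λ e → i≢ (sym e)))))))

sumTo-from : ∀ i r (F : ℕ → ℕ) → sumTo (i + r) (λ a → ⟦ i ≤ᵇ a ⟧ * F a) ≡ sumTo r (λ a' → F (i + a'))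
sumTo-from i zero F rewrite NP.+-identityʳ i = lastTerm i
  where
  lastTerm : ∀ i → sumTo i (λ a → ⟦ i ≤ᵇ a ⟧ * F a) ≡ F i
  lastTerm zero = NP.+-identityʳ (F 0)
  lastTerm (suc k) = trans (cong₂ _+_ (sumTo-zero k (λ a le → cong (λ z → ⟦ z ⟧ * F a) (≤ᵇ-> (s≤s le))))
                                      (cong (λ z → ⟦ z ⟧ * F (suc k)) (≤ᵇ-≤ (NP.≤-refl {suc k}))))
                           (NP.+-identityʳ (F (suc k)))
sumTo-from i (suc r) F rewrite NP.+-suc i r = cong₂ _+_ (sumTo-from i r F)
  (trans (cong (λ z → ⟦ z ⟧ * F (suc (i + r))) (≤ᵇ-≤ (NP.m≤n⇒m≤1+n (NP.m≤m+n i r)))) (NP.+-identityʳ _))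

-- Convolution against a term supported on a ≥ i: reindex by a' = a - i.
sumTo-shift : ∀ i p (h : ℕ → ℕ → ℕ) →
  sumTo p (λ a → ⟦ i ≤ᵇ a ⟧ * h (a ∸ i) (p ∸ a)) ≡ ⟦ i ≤ᵇ p ⟧ * sumTo (p ∸ i) (λ a' → h a' ((p ∸ i) ∸ a'))
sumTo-shift i p h with i NP.≤? p
... | no i≰p = trans (sumTo-zero p (λ a le → cong (λ z → ⟦ z ⟧ * h (a ∸ i) (p ∸ a)) (≤ᵇ-> (NP.≤-<-trans le (NP.≰⇒> i≰p)))))
                     (cong (λ z → ⟦ z ⟧ * sumTo (p ∸ i) (λ a' → h a' ((p ∸ i) ∸ a'))) (sym (≤ᵇ-> (NP.≰⇒> i≰p))))
... | yes i≤p = begin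
  sumTo p (λ a → ⟦ i ≤ᵇ a ⟧ * h (a ∸ i) (p ∸ a))
    ≡⟨ cong (λ P → sumTo P (λ a → ⟦ i ≤ᵇ a ⟧ * h (a ∸ i) (P ∸ a))) (sym (NP.m+[n∸m]≡n i≤p)) ⟩
  sumTo (i + r) (λ a → ⟦ i ≤ᵇ a ⟧ * h (a ∸ i) ((i + r) ∸ a))
    ≡⟨ sumTo-from i r (λ a → h (a ∸ i) ((i + r) ∸ a)) ⟩
  sumTo r (λ a' → h (i + a' ∸ i) ((i + r) ∸ (i + a')))
    ≡⟨ sumTo-cong r (λ a' → cong₂ h (NP.m+n∸m≡n i a') (NP.[m+n]∸[m+o]≡n∸o i r a')) ⟩
  sumTo r (λ a' → h a' (r ∸ a'))
    ≡⟨ sym (NP.+-identityʳ _) ⟩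
  1 * sumTo r (λ a' → h a' (r ∸ a'))
    ≡⟨ cong (λ z → ⟦ z ⟧ * sumTo r (λ a' → h a' (r ∸ a'))) (sym (≤ᵇ-≤ i≤p)) ⟩
  ⟦ i ≤ᵇ p ⟧ * sumTo r (λ a' → h a' (r ∸ a')) ∎
  where
  open ≡-Reasoning
  r = p ∸ i

sumTo-delta₂ : ∀ p q i j (F : ℕ → ℕ → ℕ) →
  sumTo p (λ a → sumTo q (λ b → ⟦ a ≡ᵇ i ⟧ * ⟦ b ≡ᵇ j ⟧ * F a b)) ≡ ⟦ i ≤ᵇ p ⟧ * (⟦ j ≤ᵇ q ⟧ * F i j)
sumTo-delta₂ p q i j F =
  trans (sumTo-cong p (λ a → trans (sumTo-cong q (λ b → NP.*-assoc ⟦ a ≡ᵇ i ⟧ ⟦ b ≡ᵇ j ⟧ (F a b)))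
                           (trans (sumTo-*ˡ q ⟦ a ≡ᵇ i ⟧ (λ b → ⟦ b ≡ᵇ j ⟧ * F a b))
                                  (cong (⟦ a ≡ᵇ i ⟧ *_) (sumTo-delta q j (F a))))))
        (sumTo-delta p i (λ a → ⟦ j ≤ᵇ q ⟧ * F a j))

_≗P_ : Poly → Poly → Set
P ≗P R = ∀ p q → P p q ≡ R p q

≗P-trans : ∀ {A B C} → A ≗P B → B ≗P C → A ≗P C
≗P-trans e f p q = trans (e p q) (f p q)

*P-cong : ∀ {A A' B B'} → A ≗P A' → B ≗P B' → (A *P B) ≗P (A' *P B')
*P-cong eA eB p q = sumTo-cong p (λ a → sumTo-cong q (λ b → cong₂ _*_ (eA a b) (eB (p ∸ a) (q ∸ b))))

oneP-*P : ∀ B → (oneP *P B) ≗P B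
oneP-*P B p q = begin
  (oneP *P B) p q
    ≡⟨ sumTo-cong p (λ a → sumTo-cong q (λ b → cong (_* B (p ∸ a) (q ∸ b)) (trans (if10 _) (⟦∧⟧ (a ≡ᵇ 0) (b ≡ᵇ 0))))) ⟩
  sumTo p (λ a → sumTo q (λ b → ⟦ a ≡ᵇ 0 ⟧ * ⟦ b ≡ᵇ 0 ⟧ * B (p ∸ a) (q ∸ b)))
    ≡⟨ sumTo-delta₂ p q 0 0 (λ a b → B (p ∸ a) (q ∸ b)) ⟩
  ⟦ 0 ≤ᵇ p ⟧ * (⟦ 0 ≤ᵇ q ⟧ * B p q)
    ≡⟨ cong₂ (λ x y → ⟦ x ⟧ * (⟦ y ⟧ * B p q)) (≤ᵇ-≤ (z≤n {p})) (≤ᵇ-≤ (z≤n {q})) ⟩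
  1 * (1 * B p q)
    ≡⟨ trans (NP.*-identityˡ _) (NP.*-identityˡ _) ⟩
  B p q ∎
  where open ≡-Reasoning

timesZ : ℕ → Poly → Poly
timesZ i P p q = ⟦ i ≤ᵇ p ⟧ * P (p ∸ i) q + ⟦ i ≤ᵇ q ⟧ * P p (q ∸ i)

timesZ-cong : ∀ i {A A'} → A ≗P A' → timesZ i A ≗P timesZ i A'
timesZ-cong i e p q = cong₂ _+_ (cong (⟦ i ≤ᵇ p ⟧ *_) (e (p ∸ i) q)) (cong (⟦ i ≤ᵇ q ⟧ *_) (e p (q ∸ i)))

zP-*P : ∀ i P → (zP i *P P) ≗P timesZ i P
zP-*P i P p q = begin
  (zP i *P P) p q
    ≡⟨ sumTo-cong p (λ a → trans (sumTo-cong q (λ b → trans (cong (_* P (p ∸ a) (q ∸ b)) (zP-split a b))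
                                                       (NP.*-distribʳ-+ (P (p ∸ a) (q ∸ b)) (⟦ a ≡ᵇ i ⟧ * ⟦ b ≡ᵇ 0 ⟧) _)))
                               (sumTo-+ q _ _)) ⟩
  sumTo p (λ a → sumTo q (λ b → ⟦ a ≡ᵇ i ⟧ * ⟦ b ≡ᵇ 0 ⟧ * P (p ∸ a) (q ∸ b)) +
                 sumTo q (λ b → ⟦ a ≡ᵇ 0 ⟧ * ⟦ b ≡ᵇ i ⟧ * P (p ∸ a) (q ∸ b)))
    ≡⟨ sumTo-+ p (λ a → sumTo q (λ b → ⟦ a ≡ᵇ i ⟧ * ⟦ b ≡ᵇ 0 ⟧ * P (p ∸ a) (q ∸ b)))
                 (λ a → sumTo q (λ b → ⟦ a ≡ᵇ 0 ⟧ * ⟦ b ≡ᵇ i ⟧ * P (p ∸ a) (q ∸ b))) ⟩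
  sumTo p (λ a → sumTo q (λ b → ⟦ a ≡ᵇ i ⟧ * ⟦ b ≡ᵇ 0 ⟧ * P (p ∸ a) (q ∸ b))) +
  sumTo p (λ a → sumTo q (λ b → ⟦ a ≡ᵇ 0 ⟧ * ⟦ b ≡ᵇ i ⟧ * P (p ∸ a) (q ∸ b)))
    ≡⟨ cong₂ _+_ (sumTo-delta₂ p q i 0 (λ a b → P (p ∸ a) (q ∸ b))) (sumTo-delta₂ p q 0 i (λ a b → P (p ∸ a) (q ∸ b))) ⟩
  ⟦ i ≤ᵇ p ⟧ * (⟦ 0 ≤ᵇ q ⟧ * P (p ∸ i) q) + ⟦ 0 ≤ᵇ p ⟧ * (⟦ i ≤ᵇ q ⟧ * P p (q ∸ i))
    ≡⟨ cong₂ (λ x y → ⟦ i ≤ᵇ p ⟧ * (⟦ x ⟧ * P (p ∸ i) q) + ⟦ y ⟧ * (⟦ i ≤ᵇ q ⟧ * P p (q ∸ i)))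
             (≤ᵇ-≤ (z≤n {q})) (≤ᵇ-≤ (z≤n {p})) ⟩
  ⟦ i ≤ᵇ p ⟧ * (1 * P (p ∸ i) q) + 1 * (⟦ i ≤ᵇ q ⟧ * P p (q ∸ i))
    ≡⟨ cong₂ _+_ (cong (⟦ i ≤ᵇ p ⟧ *_) (NP.*-identityˡ _)) (NP.*-identityˡ _) ⟩
  timesZ i P p q ∎
  where
  open ≡-Reasoning
  zP-split : ∀ a b → zP i a b ≡ ⟦ a ≡ᵇ i ⟧ * ⟦ b ≡ᵇ 0 ⟧ + ⟦ a ≡ᵇ 0 ⟧ * ⟦ b ≡ᵇ i ⟧
  zP-split a b = cong₂ _+_ (trans (if10 _) (⟦∧⟧ (a ≡ᵇ i) (b ≡ᵇ 0))) (trans (if10 _) (⟦∧⟧ (a ≡ᵇ 0) (b ≡ᵇ i)))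

timesZ-*P : ∀ i A B → (timesZ i A *P B) ≗P timesZ i (A *P B)
timesZ-*P i A B p q =
  trans (sumTo-cong p (λ a → trans (sumTo-cong q (λ b → distribute a b)) (sumTo-+ q _ _)))
        (trans (sumTo-+ p _ _) (cong₂ _+_ firstPart secondPart))
  where
  distribute : ∀ a b → timesZ i A a b * B (p ∸ a) (q ∸ b)
                     ≡ ⟦ i ≤ᵇ a ⟧ * (A (a ∸ i) b * B (p ∸ a) (q ∸ b)) + ⟦ i ≤ᵇ b ⟧ * (A a (b ∸ i) * B (p ∸ a) (q ∸ b))
  distribute a b = trans (NP.*-distribʳ-+ (B (p ∸ a) (q ∸ b)) (⟦ i ≤ᵇ a ⟧ * A (a ∸ i) b) (⟦ i ≤ᵇ b ⟧ * A a (b ∸ i)))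
    (cong₂ _+_ (NP.*-assoc ⟦ i ≤ᵇ a ⟧ (A (a ∸ i) b) (B (p ∸ a) (q ∸ b))) (NP.*-assoc ⟦ i ≤ᵇ b ⟧ (A a (b ∸ i)) (B (p ∸ a) (q ∸ b))))
  firstPart : sumTo p (λ a → sumTo q (λ b → ⟦ i ≤ᵇ a ⟧ * (A (a ∸ i) b * B (p ∸ a) (q ∸ b)))) ≡ ⟦ i ≤ᵇ p ⟧ * (A *P B) (p ∸ i) q
  firstPart = trans (sumTo-cong p (λ a → sumTo-*ˡ q ⟦ i ≤ᵇ a ⟧ (λ b → A (a ∸ i) b * B (p ∸ a) (q ∸ b))))
                    (sumTo-shift i p (λ a' c → sumTo q (λ b → A a' b * B c (q ∸ b))))
  secondPart : sumTo p (λ a → sumTo q (λ b → ⟦ i ≤ᵇ b ⟧ * (A a (b ∸ i) * B (p ∸ a) (q ∸ b)))) ≡ ⟦ i ≤ᵇ q ⟧ * (A *P B) p (q ∸ i)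
  secondPart = trans (sumTo-cong p (λ a → sumTo-shift i q (λ b' c → A a b' * B (p ∸ a) c)))
                     (sumTo-*ˡ p ⟦ i ≤ᵇ q ⟧ (λ a → sumTo (q ∸ i) (λ b' → A a b' * B (p ∸ a) ((q ∸ i) ∸ b'))))

≤ᵇ-∸ : ∀ i j p → ⟦ i ≤ᵇ p ⟧ * ⟦ j ≤ᵇ p ∸ i ⟧ ≡ ⟦ i + j ≤ᵇ p ⟧
≤ᵇ-∸ i j p with i NP.≤? p
... | no i≰p rewrite ≤ᵇ-> (NP.≰⇒> i≰p) | ≤ᵇ-> {i + j} {p} (NP.<-≤-trans (NP.≰⇒> i≰p) (NP.m≤m+n i j)) = refl
... | yes i≤p rewrite ≤ᵇ-≤ i≤p with j NP.≤? p ∸ i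
...   | yes j≤ = trans (cong (λ z → ⟦ z ⟧ + 0) (≤ᵇ-≤ j≤))
                       (sym (cong ⟦_⟧ (≤ᵇ-≤ (subst (i + j ≤_) (NP.m+[n∸m]≡n i≤p) (NP.+-monoʳ-≤ i j≤)))))
...   | no j≰ = trans (cong (λ z → ⟦ z ⟧ + 0) (≤ᵇ-> (NP.≰⇒> j≰)))
                      (sym (cong ⟦_⟧ (≤ᵇ-> {i + j} {p} (NP.≰⇒> λ le → j≰ (NP.m+n≤o⇒m≤o∸n j (subst (_≤ p) (NP.+-comm i j) le))))))

≤ᵇ-∸-comm : ∀ i j p (F : ℕ → ℕ) →
  ⟦ i ≤ᵇ p ⟧ * (⟦ j ≤ᵇ p ∸ i ⟧ * F (p ∸ i ∸ j)) ≡ ⟦ j ≤ᵇ p ⟧ * (⟦ i ≤ᵇ p ∸ j ⟧ * F (p ∸ j ∸ i))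
≤ᵇ-∸-comm i j p F = begin
  ⟦ i ≤ᵇ p ⟧ * (⟦ j ≤ᵇ p ∸ i ⟧ * F (p ∸ i ∸ j))
    ≡⟨ sym (NP.*-assoc ⟦ i ≤ᵇ p ⟧ ⟦ j ≤ᵇ p ∸ i ⟧ (F (p ∸ i ∸ j))) ⟩
  ⟦ i ≤ᵇ p ⟧ * ⟦ j ≤ᵇ p ∸ i ⟧ * F (p ∸ i ∸ j)
    ≡⟨ cong₂ _*_ (trans (≤ᵇ-∸ i j p) (trans (cong (λ z → ⟦ z ≤ᵇ p ⟧) (NP.+-comm i j)) (sym (≤ᵇ-∸ j i p)))) (cong F ∸-comm) ⟩
  ⟦ j ≤ᵇ p ⟧ * ⟦ i ≤ᵇ p ∸ j ⟧ * F (p ∸ j ∸ i)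
    ≡⟨ NP.*-assoc ⟦ j ≤ᵇ p ⟧ ⟦ i ≤ᵇ p ∸ j ⟧ (F (p ∸ j ∸ i)) ⟩
  ⟦ j ≤ᵇ p ⟧ * (⟦ i ≤ᵇ p ∸ j ⟧ * F (p ∸ j ∸ i)) ∎
  where
  open ≡-Reasoning
  ∸-comm : p ∸ i ∸ j ≡ p ∸ j ∸ i
  ∸-comm = trans (NP.∸-+-assoc p i j) (trans (cong (p ∸_) (NP.+-comm i j)) (sym (NP.∸-+-assoc p j i)))

timesZ-comm : ∀ i j P → timesZ i (timesZ j P) ≗P timesZ j (timesZ i P)
timesZ-comm i j P p q = begin
  ⟦ i ≤ᵇ p ⟧ * (⟦ j ≤ᵇ p ∸ i ⟧ * P (p ∸ i ∸ j) q + ⟦ j ≤ᵇ q ⟧ * P (p ∸ i) (q ∸ j)) +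
  ⟦ i ≤ᵇ q ⟧ * (⟦ j ≤ᵇ p ⟧ * P (p ∸ j) (q ∸ i) + ⟦ j ≤ᵇ q ∸ i ⟧ * P p (q ∸ i ∸ j))
    ≡⟨ cong₂ _+_ (NP.*-distribˡ-+ ⟦ i ≤ᵇ p ⟧ _ _) (NP.*-distribˡ-+ ⟦ i ≤ᵇ q ⟧ _ _) ⟩
  (T₁ + T₂) + (T₃ + T₄)
    ≡⟨ cong₂ (λ x y → (x + T₂) + (T₃ + y)) (≤ᵇ-∸-comm i j p (λ z → P z q)) (≤ᵇ-∸-comm i j q (P p)) ⟩
  (T₁' + T₂) + (T₃ + T₄')
    ≡⟨ interchange T₁' T₂ T₃ T₄' ⟩
  (T₁' + T₃) + (T₂ + T₄')
    ≡⟨ cong₂ (λ x y → (T₁' + x) + (y + T₄')) (swap-factors ⟦ i ≤ᵇ q ⟧ ⟦ j ≤ᵇ p ⟧ _) (swap-factors ⟦ i ≤ᵇ p ⟧ ⟦ j ≤ᵇ q ⟧ _) ⟩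
  (T₁' + T₃') + (T₂' + T₄')
    ≡⟨ sym (cong₂ _+_ (NP.*-distribˡ-+ ⟦ j ≤ᵇ p ⟧ _ _) (NP.*-distribˡ-+ ⟦ j ≤ᵇ q ⟧ _ _)) ⟩
  ⟦ j ≤ᵇ p ⟧ * (⟦ i ≤ᵇ p ∸ j ⟧ * P (p ∸ j ∸ i) q + ⟦ i ≤ᵇ q ⟧ * P (p ∸ j) (q ∸ i)) +
  ⟦ j ≤ᵇ q ⟧ * (⟦ i ≤ᵇ p ⟧ * P (p ∸ i) (q ∸ j) + ⟦ i ≤ᵇ q ∸ j ⟧ * P p (q ∸ j ∸ i)) ∎
  where
  open ≡-Reasoning
  T₁ = ⟦ i ≤ᵇ p ⟧ * (⟦ j ≤ᵇ p ∸ i ⟧ * P (p ∸ i ∸ j) q)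
  T₂ = ⟦ i ≤ᵇ p ⟧ * (⟦ j ≤ᵇ q ⟧ * P (p ∸ i) (q ∸ j))
  T₃ = ⟦ i ≤ᵇ q ⟧ * (⟦ j ≤ᵇ p ⟧ * P (p ∸ j) (q ∸ i))
  T₄ = ⟦ i ≤ᵇ q ⟧ * (⟦ j ≤ᵇ q ∸ i ⟧ * P p (q ∸ i ∸ j))
  T₁' = ⟦ j ≤ᵇ p ⟧ * (⟦ i ≤ᵇ p ∸ j ⟧ * P (p ∸ j ∸ i) q)
  T₂' = ⟦ j ≤ᵇ q ⟧ * (⟦ i ≤ᵇ p ⟧ * P (p ∸ i) (q ∸ j))
  T₃' = ⟦ j ≤ᵇ p ⟧ * (⟦ i ≤ᵇ q ⟧ * P (p ∸ j) (q ∸ i))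
  T₄' = ⟦ j ≤ᵇ q ⟧ * (⟦ i ≤ᵇ q ∸ j ⟧ * P p (q ∸ j ∸ i))
  swap-factors : ∀ a b x → a * (b * x) ≡ b * (a * x)
  swap-factors a b x = trans (sym (NP.*-assoc a b x)) (trans (cong (_* x) (NP.*-comm a b)) (NP.*-assoc b a x))

zProduct : List ℕ → Poly
zProduct [] = oneP
zProduct (i ∷ ls) = timesZ i (zProduct ls)

zProduct-++ : ∀ la lb → (zProduct la *P zProduct lb) ≗P zProduct (la ++ lb)
zProduct-++ [] lb = oneP-*P (zProduct lb)
zProduct-++ (i ∷ la) lb = ≗P-trans (timesZ-*P i (zProduct la) (zProduct lb)) (timesZ-cong i (zProduct-++ la lb))

zProduct-↭ : ∀ {la lb} → la ↭ lb → zProduct la ≗P zProduct lb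
zProduct-↭ ↭.refl p q = refl
zProduct-↭ (↭.prep x r) = timesZ-cong x (zProduct-↭ r)
zProduct-↭ (↭.swap {ys = ys} x y r) = ≗P-trans (timesZ-cong x (timesZ-cong y (zProduct-↭ r))) (timesZ-comm x y (zProduct ys))
zProduct-↭ (↭.trans r s) = ≗P-trans (zProduct-↭ r) (zProduct-↭ s)

zP-^P : ∀ i e → (zP i ^P e) ≗P zProduct (replicate e i)
zP-^P i zero p q = refl
zP-^P i (suc e) = ≗P-trans (zP-*P i (zP i ^P e)) (timesZ-cong i (zP-^P i e))

cycleType : ℕ → (ℕ → ℕ) → List ℕ
cycleType zero c = []
cycleType (suc M) c = cycleType M c ++ replicate (c (suc M)) (suc M)

prodFrom1-zProduct : ∀ M c → prodFrom1 M (λ i → zP i ^P c i) ≗P zProduct (cycleType M c)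
prodFrom1-zProduct zero c p q = refl
prodFrom1-zProduct (suc M) c =
  ≗P-trans (*P-cong (prodFrom1-zProduct M c) (zP-^P (suc M) (c (suc M)))) (zProduct-++ (cycleType M c) (replicate (c (suc M)) (suc M)))

cycleType-cong : ∀ M c c' → (∀ i → 1 ≤ i → i ≤ M → c i ≡ c' i) → cycleType M c ≡ cycleType M c'
cycleType-cong zero c c' h = refl
cycleType-cong (suc M) c c' h = cong₂ _++_ (cycleType-cong M c c' (λ i a b → h i a (NP.m≤n⇒m≤1+n b)))
                                           (cong (λ z → replicate z (suc M)) (h (suc M) (s≤s z≤n) NP.≤-refl))

cycleType-add : ∀ M t c c' → 1 ≤ t → t ≤ M → (∀ i → c' i ≡ c i + ⟦ i ≡ᵇ t ⟧) → cycleType M c' ↭ t ∷ cycleType M c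
cycleType-add zero t c c' () z≤n h
cycleType-add (suc M) t c c' 1≤t t≤M h with t NP.≟ suc M
... | yes refl = subst (λ z → z ↭ suc M ∷ cycleType M c ++ replicate (c (suc M)) (suc M)) (sym splitLast)
                       (PP.shift (suc M) (cycleType M c) (replicate (c (suc M)) (suc M)))
  where
  splitLast : cycleType (suc M) c' ≡ cycleType M c ++ (suc M ∷ replicate (c (suc M)) (suc M))
  splitLast = cong₂ _++_
    (cycleType-cong M c' c (λ i a b → trans (h i) (trans (cong (λ z → c i + ⟦ z ⟧) (≡ᵇ-≢ (λ ei → NP.<-irrefl ei (s≤s b)))) (NP.+-identityʳ (c i)))))
    (cong (λ z → replicate z (suc M)) (trans (h (suc M)) (trans (cong (λ z → c (suc M) + ⟦ z ⟧) (≡ᵇ-refl (suc M))) (NP.+-comm (c (suc M)) 1))))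
... | no t≢ = subst (λ z → cycleType M c' ++ z ↭ t ∷ cycleType M c ++ replicate (c (suc M)) (suc M)) (cong (λ z → replicate z (suc M)) (sym last≡))
                    (PP.++⁺ʳ (replicate (c (suc M)) (suc M)) (cycleType-add M t c c' 1≤t (NP.≤-pred (NP.≤∧≢⇒< t≤M t≢)) h))
  where
  last≡ : c' (suc M) ≡ c (suc M)
  last≡ = trans (h (suc M)) (trans (cong (λ z → c (suc M) + ⟦ z ⟧) (≡ᵇ-≢ (λ ei → t≢ (sym ei)))) (NP.+-identityʳ _))

-- The first index in [u , u + k) satisfying P (u + k if there is none).
firstHit : (ℕ → Bool) → ℕ → ℕ → ℕ
firstHit P u zero = u
firstHit P u (suc k) = if P u then u else firstHit P (suc u) k

firstHit-≥ : ∀ P u k → u ≤ firstHit P u k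
firstHit-≥ P u zero = NP.≤-refl
firstHit-≥ P u (suc k) with P u
... | true = NP.≤-refl
... | false = NP.≤-trans (NP.n≤1+n u) (firstHit-≥ P (suc u) k)

firstHit-before : ∀ P u k v → u ≤ v → v < firstHit P u k → P v ≡ false
firstHit-before P u zero v le lt = ⊥-elim (NP.<-irrefl refl (NP.<-≤-trans lt le))
firstHit-before P u (suc k) v le lt with P u in e
... | true = ⊥-elim (NP.<-irrefl refl (NP.<-≤-trans lt le))
... | false with u NP.≟ v
...   | yes refl = e
...   | no u≢v = firstHit-before P (suc u) k v (NP.≤∧≢⇒< le u≢v) lt

firstHit-hit : ∀ P u k s → u ≤ s → s < u + k → P s ≡ true → (P (firstHit P u k) ≡ true) × (firstHit P u k ≤ s)
firstHit-hit P u zero s le lt e = ⊥-elim (NP.<-irrefl refl (NP.<-≤-trans lt (NP.≤-trans (NP.≤-reflexive (NP.+-identityʳ u)) le)))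
firstHit-hit P u (suc k) s le lt e with P u in q
... | true = q , le
... | false with u NP.≟ s
...   | yes refl = ⊥-elim (true≢false (trans (sym e) q))
...   | no u≢s = firstHit-hit P (suc u) k s (NP.≤∧≢⇒< le u≢s) (NP.<-≤-trans lt (NP.≤-reflexive (NP.+-suc u k))) e

noEarlierReturn : (ℕ → Bool) → List ℕ → Bool
noEarlierReturn P = L.foldr (λ t b → not (P t) ∧ b) true

noEarlierReturn-true : ∀ (P : ℕ → Bool) (f : ℕ → ℕ) j → (∀ u → u < j → P (f u) ≡ false) → noEarlierReturn P (applyUpTo f j) ≡ true
noEarlierReturn-true P f zero h = refl
noEarlierReturn-true P f (suc j) h rewrite h 0 (s≤s z≤n) = noEarlierReturn-true P (λ u → f (suc u)) j (λ u lt → h (suc u) (s≤s lt))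

noEarlierReturn-false : ∀ (P : ℕ → Bool) (f : ℕ → ℕ) j u → u < j → P (f u) ≡ true → noEarlierReturn P (applyUpTo f j) ≡ false
noEarlierReturn-false P f (suc j) zero lt e rewrite e = refl
noEarlierReturn-false P f (suc j) (suc u) (s≤s lt) e rewrite noEarlierReturn-false P (λ u → f (suc u)) j u lt e =
  BP.∧-zeroʳ (not (P (f 0)))

noEarlierReturn-cong : ∀ (P R : ℕ → Bool) xs → (∀ t → P t ≡ R t) → noEarlierReturn P xs ≡ noEarlierReturn R xs
noEarlierReturn-cong P R [] h = refl
noEarlierReturn-cong P R (x ∷ xs) h = cong₂ (λ a b → not a ∧ b) (h x) (noEarlierReturn-cong P R xs h)

module Cycles {n} (w : SPerm n) (sw : IsSignedPerm w) where

  g : Vertex n → Vertex n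
  g = actV w

  iter-+ : ∀ a b x → iter w (a + b) x ≡ iter w a (iter w b x)
  iter-+ zero b x = refl
  iter-+ (suc a) b x = cong g (iter-+ a b x)

  iter-g : ∀ a x → iter w a (g x) ≡ g (iter w a x)
  iter-g zero x = refl
  iter-g (suc a) x = cong g (iter-g a x)

  iter-injective : ∀ a {x y} → iter w a x ≡ iter w a y → x ≡ y
  iter-injective zero e = e
  iter-injective (suc a) {x} {y} e = iter-injective a (actV-injective w sw {iter w a x} {iter w a y} e)

  iter-cancel : ∀ a s x → iter w (a + s) x ≡ iter w a x → iter w s x ≡ x
  iter-cancel a s x e = iter-injective a (trans (sym (iter-+ a s x)) e)

  Closed : List (Vertex n) → Set
  Closed Y = ∀ y → y ∈ Y → g y ∈ Y

  iter-closed : ∀ Y → Closed Y → ∀ a x → x ∈ Y → iter w a x ∈ Y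
  iter-closed Y cl zero x m = m
  iter-closed Y cl (suc a) x m = cl _ (iter-closed Y cl a x m)

  returns : ∀ Y → Closed Y → ∀ x → x ∈ Y → Σ ℕ λ s → (1 ≤ s) × (s ≤ length Y) × (iter w s x ≡ x)
  returns Y cl x m with FP.pigeonhole (NP.n<1+n (length Y)) position
    where
    position : Fin (suc (length Y)) → Fin (length Y)
    position k = Any.index (iter-closed Y cl (toℕ k) x m)
  ... | i , j , i<j , same = s , NP.m<n⇒0<n∸m i<j , s≤L , iter-cancel (toℕ i) s x (trans (cong (λ z → iter w z x) i+s≡j) (sym meet))
    where
    s = toℕ j ∸ toℕ i
    i+s≡j : toℕ i + s ≡ toℕ j
    i+s≡j = NP.m+[n∸m]≡n (NP.<⇒≤ i<j)
    s≤L : s ≤ length Y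
    s≤L = NP.≤-trans (NP.m∸n≤m (toℕ j) (toℕ i)) (NP.≤-pred (FP.toℕ<n j))
    meet : iter w (toℕ i) x ≡ iter w (toℕ j) x
    meet = trans (AnyP.lookup-index (iter-closed Y cl (toℕ i) x m))
             (trans (cong (L.lookup Y) same) (sym (AnyP.lookup-index (iter-closed Y cl (toℕ j) x m))))

  returnsᵇ : ℕ → Vertex n → Bool
  returnsᵇ t x = iter w t x ==V x

  returnsᵇ-g : ∀ v x → returnsᵇ v (g x) ≡ returnsᵇ v x
  returnsᵇ-g v x = bool-ext
    (λ e → ≡⇒==V (actV-injective w sw {iter w v x} {x} (trans (sym (iter-g v x)) (==V-≡ {u = iter w v (g x)} e))))
    (λ e → ≡⇒==V (trans (iter-g v x) (cong g (==V-≡ {u = iter w v x} e))))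
    where
    ≡⇒==V : ∀ {u v : Vertex n} → u ≡ v → (u ==V v) ≡ true
    ≡⇒==V {u} refl = ==V-refl u

  record MinimalPeriod (x : Vertex n) (t : ℕ) : Set where
    field
      positive : 1 ≤ t
      returns-at : iter w t x ≡ x
      minimal : ∀ v → 1 ≤ v → v < t → returnsᵇ v x ≡ false

  period : ℕ → Vertex n → ℕ
  period B x = firstHit (λ t → returnsᵇ t x) 1 B

  period-spec : ∀ B x s → 1 ≤ s → s ≤ B → iter w s x ≡ x → MinimalPeriod x (period B x) × (period B x ≤ s)
  period-spec B x s s≥1 s≤B e =
    record { positive = firstHit-≥ _ 1 B ; returns-at = ==V-≡ (proj₁ hit) ; minimal = λ v a b → firstHit-before _ 1 B v a b } , proj₂ hit
    where
    hit = firstHit-hit (λ t → returnsᵇ t x) 1 B s s≥1 (s≤s s≤B) (trans (cong (_==V x) e) (==V-refl x))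

  cycleLenIs-period : ∀ x t → MinimalPeriod x t → ∀ i → cycleLenIs w i x ≡ (i ≡ᵇ t)
  cycleLenIs-period x zero mp i = ⊥-elim (NP.<-irrefl refl (MinimalPeriod.positive mp))
  cycleLenIs-period x (suc t') mp zero = refl
  cycleLenIs-period x (suc t') mp (suc j) with NP.<-cmp j t'
  ... | tri< j<t _ _ rewrite MinimalPeriod.minimal mp (suc j) (s≤s z≤n) (s≤s j<t) = sym (≡ᵇ-≢ (λ e → NP.<-irrefl (cong suc e) (s≤s j<t)))
  ... | tri≈ _ refl _ rewrite trans (cong (_==V x) (MinimalPeriod.returns-at mp)) (==V-refl x)
        = trans (noEarlierReturn-true (λ u → returnsᵇ (suc u) x) (λ u → u) j (λ u lt → MinimalPeriod.minimal mp (suc u) (s≤s z≤n) (s≤s lt)))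
                (sym (≡ᵇ-refl j))
  ... | tri> _ _ t<j = trans (and-false (noEarlierReturn-false (λ u → returnsᵇ (suc u) x) (λ u → u) j t' t<j
                                           (trans (cong (_==V x) (MinimalPeriod.returns-at mp)) (==V-refl x))))
                             (sym (≡ᵇ-≢ {suc j} {suc t'} (λ e → NP.<-irrefl (sym (NP.suc-injective e)) t<j)))
    where
    and-false : ∀ {a b} → b ≡ false → a ∧ b ≡ false
    and-false {false} e = refl
    and-false {true} e = e

  cycleLenIs-g : ∀ i x → cycleLenIs w i (g x) ≡ cycleLenIs w i x
  cycleLenIs-g zero x = refl
  cycleLenIs-g (suc j) x = cong₂ _∧_ (returnsᵇ-g (suc j) x)
    (noEarlierReturn-cong (λ u → returnsᵇ (suc u) (g x)) (λ u → returnsᵇ (suc u) x) (upTo j) (λ u → returnsᵇ-g (suc u) x))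

  cycleLenIs-iter : ∀ i j x → cycleLenIs w i (iter w j x) ≡ cycleLenIs w i x
  cycleLenIs-iter i zero x = refl
  cycleLenIs-iter i (suc j) x = trans (cycleLenIs-g i (iter w j x)) (cycleLenIs-iter i j x)

  invariantOn : List (Vertex n) → Sub n → Bool
  invariantOn D τ = allB (λ y → beq (τ (g y)) (τ y)) D

  orbit : Vertex n → ℕ → List (Vertex n)
  orbit x t = applyUpTo (λ j → iter w j x) t

  module Orbit (x : Vertex n) (t : ℕ) (mp : MinimalPeriod x t) where

    open MinimalPeriod mp

    orbit-length : length (orbit x t) ≡ t
    orbit-length = LP.length-applyUpTo _ t

    orbit-unique : Unique (orbit x t)
    orbit-unique = UP.applyUpTo⁺₁ (λ j → iter w j x) t distinct
      where
      distinct : ∀ {i j} → i < j → j < t → iter w i x ≢ iter w j x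
      distinct {i} {j} i<j j<t e = true≢false (trans (sym back) (minimal (j ∸ i) (NP.m<n⇒0<n∸m i<j) (NP.≤-<-trans (NP.m∸n≤m j i) j<t)))
        where
        back : returnsᵇ (j ∸ i) x ≡ true
        back = trans (cong (_==V x) (iter-cancel i (j ∸ i) x (trans (cong (λ z → iter w z x) (NP.m+[n∸m]≡n (NP.<⇒≤ i<j))) (sym e))))
                     (==V-refl x)

    orbit-∈ : ∀ j → j < t → iter w j x ∈ orbit x t
    orbit-∈ j lt = MP.∈-applyUpTo⁺ (λ j → iter w j x) lt

    orbit-∈⁻ : ∀ c → c ∈ orbit x t → ∃ λ j → (j < t) × (c ≡ iter w j x)
    orbit-∈⁻ c m = MP.∈-applyUpTo⁻ (λ j → iter w j x) m

    orbit-⊆ : ∀ Y → Closed Y → x ∈ Y → ∀ c → c ∈ orbit x t → c ∈ Y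
    orbit-⊆ Y cl x∈Y c m with orbit-∈⁻ c m
    ... | j , _ , refl = iter-closed Y cl j x x∈Y

    orbit-closed : ∀ c → c ∈ orbit x t → g c ∈ orbit x t
    orbit-closed c m with orbit-∈⁻ c m
    ... | j , lt , refl with suc j NP.<? t
    ...   | yes sj<t = orbit-∈ (suc j) sj<t
    ...   | no ¬sj<t = subst (_∈ orbit x t) (sym (trans (cong (λ z → iter w z x) (NP.≤-antisym lt (NP.≮⇒≥ ¬sj<t))) returns-at))
                             (orbit-∈ 0 positive)

    orbit-closed⁻ : ∀ y → g y ∈ orbit x t → y ∈ orbit x t
    orbit-closed⁻ y m with orbit-∈⁻ (g y) m
    ... | suc j , lt , e = subst (_∈ orbit x t) (sym (actV-injective w sw {y} {iter w j x} e)) (orbit-∈ j (NP.<-trans (NP.n<1+n j) lt))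
    ... | zero , lt , e = subst (_∈ orbit x t)
          (sym (actV-injective w sw {y} {iter w (t ∸ 1) x} (trans e (trans (sym returns-at) (cong (λ z → iter w z x) (sym t≡1+t-1))))))
                                (orbit-∈ (t ∸ 1) (NP.∸-monoʳ-< {t} {1} {0} (s≤s z≤n) positive))
      where
      t≡1+t-1 : suc (t ∸ 1) ≡ t
      t≡1+t-1 = NP.m+[n∸m]≡n positive

    invariant⇔constant : ∀ τ → invariantOn (orbit x t) τ ≡ agreesOn (orbit x t) τ (λ _ → τ x)
    invariant⇔constant τ = bool-ext to from
      where
      to : invariantOn (orbit x t) τ ≡ true → agreesOn (orbit x t) τ (λ _ → τ x) ≡ true
      to e = ⇒allB _ (orbit x t) λ c m → constant c m
        where
        along : ∀ j → j < t → τ (iter w j x) ≡ τ x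
        along zero _ = refl
        along (suc j) lt = trans (beq-≡ (allB⇒ _ (orbit x t) e (iter w j x) (orbit-∈ j (NP.<-trans (NP.n<1+n j) lt))))
                                 (along j (NP.<-trans (NP.n<1+n j) lt))
        constant : ∀ c → c ∈ orbit x t → beq (τ c) (τ x) ≡ true
        constant c m with orbit-∈⁻ c m
        ... | j , lt , refl = ≡-beq (along j lt)
      from : agreesOn (orbit x t) τ (λ _ → τ x) ≡ true → invariantOn (orbit x t) τ ≡ true
      from e = ⇒allB _ (orbit x t) λ c m →
        ≡-beq (trans (beq-≡ (allB⇒ _ (orbit x t) e (g c) (orbit-closed c m))) (sym (beq-≡ (allB⇒ _ (orbit x t) e c m))))

    count-orbit : ∀ (P : Vertex n → Bool) b → (∀ c → c ∈ orbit x t → P c ≡ b) → count P (orbit x t) ≡ ⟦ b ⟧ * t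
    count-orbit P b h = trans (count-uniform P b (orbit x t) h) (cong (⟦ b ⟧ *_) orbit-length)

    countCycleLen-orbit : ∀ i → count (cycleLenIs w i) (orbit x t) ≡ ⟦ i ≡ᵇ t ⟧ * t
    countCycleLen-orbit i = count-orbit (cycleLenIs w i) (i ≡ᵇ t) λ c m → onOrbit c m
      where
      onOrbit : ∀ c → c ∈ orbit x t → cycleLenIs w i c ≡ (i ≡ᵇ t)
      onOrbit c m with orbit-∈⁻ c m
      ... | j , lt , refl = trans (cycleLenIs-iter i j x) (cycleLenIs-period x t mp i)

_∈V?_ : ∀ {n} (v : Vertex n) (C : List (Vertex n)) → Dec (v ∈ C)
v ∈V? C = Any.any? (VP.≡-dec BP._≟_ v) C

outside : ∀ {n} → List (Vertex n) → List (Vertex n) → List (Vertex n)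
outside C Y = filter (λ y → ¬? (y ∈V? C)) Y

split-↭ : ∀ {n} (Y C : List (Vertex n)) → Unique Y → Unique C → (∀ c → c ∈ C → c ∈ Y) → Y ↭ C ++ outside C Y
split-↭ Y C uY uC C⊆Y = ∼bag⇒↭ (unique∧set⇒bag uY (UP.++⁺ uC (UP.filter⁺ _ uY) disjoint) (mk⇔ to from))
  where
  disjoint : ∀ {v} → v ∈ C × v ∈ outside C Y → ⊥
  disjoint (v∈C , v∈rest) = proj₂ (MP.∈-filter⁻ (λ y → ¬? (y ∈V? C)) {xs = Y} v∈rest) v∈C
  to : ∀ {v} → v ∈ Y → v ∈ C ++ outside C Y
  to {v} m with v ∈V? C
  ... | yes v∈C = MP.∈-++⁺ˡ v∈C
  ... | no v∉C = MP.∈-++⁺ʳ C (MP.∈-filter⁺ (λ y → ¬? (y ∈V? C)) m v∉C)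
  from : ∀ {v} → v ∈ C ++ outside C Y → v ∈ Y
  from {v} m with MP.∈-++⁻ C m
  ... | inj₁ v∈C = C⊆Y v v∈C
  ... | inj₂ v∈rest = proj₁ (MP.∈-filter⁻ (λ y → ¬? (y ∈V? C)) {xs = Y} v∈rest)

+-≡ᵇ : ∀ t a p → (t + a ≡ᵇ p) ≡ (t ≤ᵇ p) ∧ (a ≡ᵇ p ∸ t)
+-≡ᵇ t a p with t NP.≤? p
... | yes t≤p rewrite ≤ᵇ-≤ t≤p = bool-ext
       (λ e → ≡⇒≡ᵇ (NP.+-cancelˡ-≡ t a (p ∸ t) (trans (≡ᵇ-≡ e) (sym (NP.m+[n∸m]≡n t≤p)))))
       (λ e → ≡⇒≡ᵇ (trans (cong (t +_) (≡ᵇ-≡ e)) (NP.m+[n∸m]≡n t≤p)))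
  where
  ≡⇒≡ᵇ : ∀ {x y} → x ≡ y → (x ≡ᵇ y) ≡ true
  ≡⇒≡ᵇ {x} refl = ≡ᵇ-refl x
... | no t≰p rewrite ≤ᵇ-> (NP.≰⇒> t≰p) = ≡ᵇ-≢ (λ e → t≰p (subst (t ≤_) e (NP.m≤m+n t a)))

-- An orbit of length t lying entirely inside τ, resp. outside τ, uses up t of the
-- first, resp. second, exponent.
orbitInside : ∀ I t a b p q → ⟦ I ∧ ((t + a ≡ᵇ p) ∧ (0 + b ≡ᵇ q)) ⟧ ≡ ⟦ t ≤ᵇ p ⟧ * ⟦ I ∧ ((a ≡ᵇ p ∸ t) ∧ (b ≡ᵇ q)) ⟧
orbitInside I t a b p q rewrite +-≡ᵇ t a p with t ≤ᵇ p
... | true = sym (NP.+-identityʳ _)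
... | false = cong ⟦_⟧ (BP.∧-zeroʳ I)

orbitOutside : ∀ I t a b p q → ⟦ I ∧ ((0 + a ≡ᵇ p) ∧ (t + b ≡ᵇ q)) ⟧ ≡ ⟦ t ≤ᵇ q ⟧ * ⟦ I ∧ ((a ≡ᵇ p) ∧ (b ≡ᵇ q ∸ t)) ⟧
orbitOutside I t a b p q rewrite +-≡ᵇ t b q with t ≤ᵇ q
... | true = sym (NP.+-identityʳ _)
... | false = trans (cong (λ z → ⟦ I ∧ z ⟧) (BP.∧-zeroʳ (a ≡ᵇ p))) (cong ⟦_⟧ (BP.∧-zeroʳ I))

module Polya {n} (w : SPerm n) (sw : IsSignedPerm w) (M : ℕ) where

  open Cycles w sw

  invariantWith : List (Vertex n) → ℕ → ℕ → Sub n → ℕ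
  invariantWith Y p q τ = ⟦ invariantOn Y τ ∧ ((count τ Y ≡ᵇ p) ∧ (count (λ v → not (τ v)) Y ≡ᵇ q)) ⟧

  cyclesIn : List (Vertex n) → ℕ → ℕ
  cyclesIn Y zero = 0
  cyclesIn Y (suc j) = count (cycleLenIs w (suc j)) Y / suc j

  invariantWith-local : ∀ Y p q τ τ' → (∀ y → y ∈ Y → (τ' y ≡ τ y) × (τ' (g y) ≡ τ (g y))) →
                        invariantWith Y p q τ' ≡ invariantWith Y p q τ
  invariantWith-local Y p q τ τ' h = cong ⟦_⟧ (cong₂ _∧_ (allB-cong Y (λ y m → cong₂ beq (proj₂ (h y m)) (proj₁ (h y m))))
    (cong₂ _∧_ (cong (_≡ᵇ p) (sumL-cong Y (λ y m → cong ⟦_⟧ (proj₁ (h y m)))))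
               (cong (_≡ᵇ q) (sumL-cong Y (λ y m → cong (λ z → ⟦ not z ⟧) (proj₁ (h y m)))))))

  invariantWith-ext : ∀ Y p q → Extensional (invariantWith Y p q)
  invariantWith-ext Y p q τ τ' h = sym (invariantWith-local Y p q τ τ' (λ y _ → sym (h y) , sym (h (g y))))

  polya-empty : ∀ p q → invariantWith [] p q (λ _ → false) ≡ zProduct (cycleType M (cyclesIn [])) p q
  polya-empty p q = trans (emptyCount p q) (cong (λ l → zProduct l p q) (sym (noCycles M)))
    where
    emptyCount : ∀ p q → ⟦ true ∧ ((0 ≡ᵇ p) ∧ (0 ≡ᵇ q)) ⟧ ≡ oneP p q
    emptyCount zero zero = refl
    emptyCount zero (suc q) = refl
    emptyCount (suc p) q = refl
    noCycles : ∀ M → cycleType M (cyclesIn []) ≡ []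
    noCycles zero = refl
    noCycles (suc M) rewrite noCycles M = refl

  module PeelOrbit (x : Vertex n) (t : ℕ) (mp : MinimalPeriod x t) (Y Y' : List (Vertex n))
                   (Y↭ : Y ↭ orbit x t ++ Y') (closed' : Closed Y') (disjoint : ∀ y → y ∈ Y' → y ∉ orbit x t) where

    open Orbit x t mp
    open MinimalPeriod mp

    C = orbit x t

    -- The two cases: C ⊆ τ, or C ∩ τ = ∅.
    allIn allOut : ℕ → ℕ → Sub n → ℕ
    allIn p q τ = ⟦ t ≤ᵇ p ⟧ * invariantWith Y' (p ∸ t) q τ
    allOut p q τ = ⟦ t ≤ᵇ q ⟧ * invariantWith Y' p (q ∸ t) τ

    invariantWith-split : ∀ p q τ → invariantWith Y p q τ ≡
      ⟦ (invariantOn C τ ∧ invariantOn Y' τ) ∧ ((count τ C + count τ Y' ≡ᵇ p) ∧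
                                               (count (λ v → not (τ v)) C + count (λ v → not (τ v)) Y' ≡ᵇ q)) ⟧
    invariantWith-split p q τ = cong ⟦_⟧ (cong₂ _∧_ (trans (allB-↭ _ Y↭) (allB-++ _ C Y'))
      (cong₂ _∧_ (cong (_≡ᵇ p) (trans (count-↭ τ Y↭) (count-++ τ C Y')))
                 (cong (_≡ᵇ q) (trans (count-↭ (λ v → not (τ v)) Y↭) (count-++ (λ v → not (τ v)) C Y')))))

    x∈C : x ∈ C
    x∈C = orbit-∈ 0 positive

    -- Pointwise: an invariant τ either contains C or misses it.
    pointwise : ∀ p q τ → invariantWith Y p q τ ≡ ⟦ agreesOn C τ (λ _ → true) ⟧ * allIn p q τ + ⟦ agreesOn C τ (λ _ → false) ⟧ * allOut p q τ
    pointwise p q τ = trans (invariantWith-split p q τ) (byValue (τ x) refl)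
      where
      I' = invariantOn Y' τ
      a = count τ Y'
      b = count (λ v → not (τ v)) Y'
      agrees-own : ∀ c → τ x ≡ c → agreesOn C τ (λ _ → c) ≡ invariantOn C τ
      agrees-own c e = trans (cong (λ c → agreesOn C τ (λ _ → c)) (sym e)) (sym (invariant⇔constant τ))
      agrees-other : ∀ c c' → τ x ≡ c → beq c c' ≡ false → agreesOn C τ (λ _ → c') ≡ false
      agrees-other c c' e ne = allB-false (λ d → beq (τ d) c') C x x∈C (trans (cong (λ z → beq z c') e) ne)
      constantOn : ∀ c → τ x ≡ c → invariantOn C τ ≡ true → ∀ y → y ∈ C → τ y ≡ c
      constantOn c e inv y m = trans (beq-≡ (allB⇒ _ C (trans (sym (invariant⇔constant τ)) inv) y m)) e
      byValue : ∀ c → τ x ≡ c →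
        ⟦ (invariantOn C τ ∧ I') ∧ ((count τ C + a ≡ᵇ p) ∧ (count (λ v → not (τ v)) C + b ≡ᵇ q)) ⟧
          ≡ ⟦ agreesOn C τ (λ _ → true) ⟧ * allIn p q τ + ⟦ agreesOn C τ (λ _ → false) ⟧ * allOut p q τ
      byValue true e with invariantOn C τ in inv
      ... | false rewrite trans (agrees-own true e) inv | agrees-other true false e refl = refl
      ... | true rewrite trans (agrees-own true e) inv | agrees-other true false e refl
                       | trans (count-orbit τ true (constantOn true e inv)) (NP.*-identityˡ t)
                       | count-orbit (λ v → not (τ v)) false (λ y m → cong not (constantOn true e inv y m))
                       = trans (orbitInside I' t a b p q) (sym (trans (NP.+-identityʳ _) (NP.+-identityʳ _)))
      byValue false e with invariantOn C τ in inv
      ... | false rewrite trans (agrees-own false e) inv | agrees-other false true e refl = refl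
      ... | true rewrite trans (agrees-own false e) inv | agrees-other false true e refl
                       | count-orbit τ false (constantOn false e inv)
                       | trans (count-orbit (λ v → not (τ v)) true (λ y m → cong not (constantOn false e inv y m))) (NP.*-identityˡ t)
                       = trans (orbitOutside I' t a b p q) (sym (NP.+-identityʳ _))

    -- Summing over the reassignments on C keeps exactly the two constant choices,
    -- since invariantWith Y' ignores the values on C.
    sumOverOrbit : ∀ p q σ → sumOver C (invariantWith Y p q) σ ≡ allIn p q σ + allOut p q σ
    sumOverOrbit p q σ = trans (sumOver-cong C (pointwise p q) σ)
      (trans (sumOver-+ C (λ τ → ⟦ agreesOn C τ (λ _ → true) ⟧ * allIn p q τ)
                          (λ τ → ⟦ agreesOn C τ (λ _ → false) ⟧ * allOut p q τ) σ)
        (cong₂ _+_ (sumOver-pin C (λ _ → true) (allIn p q) orbit-unique (insensitive (p ∸ t) q ⟦ t ≤ᵇ p ⟧) σ)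
                   (sumOver-pin C (λ _ → false) (allOut p q) orbit-unique (insensitive p (q ∸ t) ⟦ t ≤ᵇ q ⟧) σ)))
      where
      insensitive : ∀ p' q' k d → d ∈ C → ∀ c τ → k * invariantWith Y' p' q' (assign d c τ) ≡ k * invariantWith Y' p' q' τ
      insensitive p' q' k d d∈C c τ = cong (k *_) (invariantWith-local Y' p' q' τ (assign d c τ) λ y m →
        assign-there d c τ y (λ e → disjoint y m (subst (_∈ C) (sym e) d∈C)) ,
        assign-there d c τ (g y) (λ e → disjoint (g y) (closed' y m) (subst (_∈ C) (sym e) d∈C)))

    cyclesIn-peel : ∀ i → cyclesIn Y i ≡ cyclesIn Y' i + ⟦ i ≡ᵇ t ⟧
    cyclesIn-peel zero = sym (cong ⟦_⟧ (≡ᵇ-≢ (λ e → NP.<-irrefl e positive)))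
    cyclesIn-peel (suc j) =
      trans (cong (_/ suc j) (trans (count-↭ (cycleLenIs w (suc j)) Y↭)
                             (trans (count-++ (cycleLenIs w (suc j)) C Y') (cong (_+ N') (countCycleLen-orbit (suc j))))))
            (divide (suc j NP.≟ t))
      where
      N' = count (cycleLenIs w (suc j)) Y'
      divide : Dec (suc j ≡ t) → (⟦ suc j ≡ᵇ t ⟧ * t + N') / suc j ≡ N' / suc j + ⟦ suc j ≡ᵇ t ⟧
      divide (yes refl) rewrite ≡ᵇ-refl j | NP.+-identityʳ j =
        trans (DM.m/n≡1+[m∸n]/n {suc j + N'} {suc j} (NP.m≤m+n (suc j) N'))
              (trans (cong (λ z → 1 + z / suc j) (NP.m+n∸m≡n (suc j) N')) (NP.+-comm 1 (N' / suc j)))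
      divide (no ne) rewrite ≡ᵇ-≢ ne = sym (NP.+-identityʳ _)

    peel : (∀ p q → sumSubsets Y' (invariantWith Y' p q) ≡ zProduct (cycleType M (cyclesIn Y')) p q) → t ≤ M →
           ∀ p q → sumSubsets Y (invariantWith Y p q) ≡ zProduct (cycleType M (cyclesIn Y)) p q
    peel IH t≤M p q = begin
      sumOver Y (invariantWith Y p q) ∅
        ≡⟨ sumOver-↭ Y↭ (invariantWith Y p q) (invariantWith-ext Y p q) ∅ ⟩
      sumOver (C ++ Y') (invariantWith Y p q) ∅
        ≡⟨ sumOver-++ C Y' (invariantWith Y p q) ∅ ⟩
      sumOver Y' (sumOver C (invariantWith Y p q)) ∅
        ≡⟨ sumOver-cong Y' (sumOverOrbit p q) ∅ ⟩
      sumOver Y' (λ σ → allIn p q σ + allOut p q σ) ∅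
        ≡⟨ sumOver-+ Y' (allIn p q) (allOut p q) ∅ ⟩
      sumOver Y' (allIn p q) ∅ + sumOver Y' (allOut p q) ∅
        ≡⟨ cong₂ _+_ (sumOver-*ˡ Y' ⟦ t ≤ᵇ p ⟧ (invariantWith Y' (p ∸ t) q) ∅)
                     (sumOver-*ˡ Y' ⟦ t ≤ᵇ q ⟧ (invariantWith Y' p (q ∸ t)) ∅) ⟩
      ⟦ t ≤ᵇ p ⟧ * sumSubsets Y' (invariantWith Y' (p ∸ t) q) + ⟦ t ≤ᵇ q ⟧ * sumSubsets Y' (invariantWith Y' p (q ∸ t))
        ≡⟨ cong₂ _+_ (cong (⟦ t ≤ᵇ p ⟧ *_) (IH (p ∸ t) q)) (cong (⟦ t ≤ᵇ q ⟧ *_) (IH p (q ∸ t))) ⟩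
      zProduct (t ∷ cycleType M (cyclesIn Y')) p q
        ≡⟨ sym (zProduct-↭ (cycleType-add M t (cyclesIn Y') (cyclesIn Y) positive t≤M cyclesIn-peel) p q) ⟩
      zProduct (cycleType M (cyclesIn Y)) p q ∎
      where
      open ≡-Reasoning
      ∅ : Sub n
      ∅ = λ _ → false

  -- Pólya's count: for a closed duplicate-free Y, the w-invariant subsets of Y with
  -- p elements and q non-elements are counted by [u₁^p u₂^q] Π_i z_i^(cycles of length i).
  -- (fuel bounds the recursion, which removes one orbit at a time.)
  polya : ∀ fuel Y → length Y ≤ fuel → length Y ≤ M → Unique Y → Closed Y →
          ∀ p q → sumSubsets Y (invariantWith Y p q) ≡ zProduct (cycleType M (cyclesIn Y)) p q
  polya fuel [] _ _ _ _ p q = polya-empty p q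
  polya zero (x ∷ Y₀) () _ _ _ p q
  polya (suc fuel) (x ∷ Y₀) Y≤fuel Y≤M uY cl p q = PeelOrbit.peel x t mp Y Y' Y↭ closed' disjoint IH t≤M p q
    where
    Y = x ∷ Y₀
    ret = returns Y cl x (here refl)
    s = proj₁ ret
    s≤Y = proj₁ (proj₂ (proj₂ ret))
    least = period-spec M x s (proj₁ (proj₂ ret)) (NP.≤-trans s≤Y Y≤M) (proj₂ (proj₂ (proj₂ ret)))
    t = period M x
    mp = proj₁ least
    open Orbit x t mp
    C = orbit x t
    Y' = outside C Y
    Y↭ = split-↭ Y C uY orbit-unique (orbit-⊆ Y cl (here refl))
    disjoint : ∀ y → y ∈ Y' → y ∉ C
    disjoint y m = proj₂ (MP.∈-filter⁻ (λ y → ¬? (y ∈V? C)) {xs = Y} m)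
    closed' : Closed Y'
    closed' y m = MP.∈-filter⁺ (λ y → ¬? (y ∈V? C)) (cl y (proj₁ (MP.∈-filter⁻ (λ y → ¬? (y ∈V? C)) {xs = Y} m)))
                               (λ gy∈C → disjoint y m (orbit-closed⁻ y gy∈C))
    length-Y : length Y ≡ t + length Y'
    length-Y = trans (PP.↭-length Y↭) (trans (LP.length-++ C) (cong (_+ length Y') orbit-length))
    Y'≤fuel : length Y' ≤ fuel
    Y'≤fuel = NP.≤-pred (NP.<-≤-trans (subst (length Y' <_) (sym length-Y) (NP.m<n+m (length Y') (MinimalPeriod.positive mp))) Y≤fuel)
    IH = polya fuel Y' Y'≤fuel (NP.≤-trans (NP.≤-trans (NP.m≤n+m (length Y') t) (NP.≤-reflexive (sym length-Y))) Y≤M)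
               (UP.filter⁺ (λ y → ¬? (y ∈V? C)) uY) closed'
    t≤M = NP.≤-trans (proj₂ least) (NP.≤-trans s≤Y Y≤M)

module _ {n : ℕ} where

  MapsTo : SPerm n → Sub n → Sub n → Set
  MapsTo w S S' = ∀ x → S' (actV w x) ≡ S x

  mapsToᵇ : SPerm n → Sub n → Sub n → Bool
  mapsToᵇ w S S' = allB (λ x → beq (S' (actV w x)) (S x)) (allVertices n)

  mapsToᵇ⇒ : ∀ w S S' → mapsToᵇ w S S' ≡ true → MapsTo w S S'
  mapsToᵇ⇒ w S S' e x = beq-≡ (allB⇒ _ (allVertices n) e x (allVertices-complete x))

  ⇒mapsToᵇ : ∀ w S S' → MapsTo w S S' → mapsToᵇ w S S' ≡ true
  ⇒mapsToᵇ w S S' r = ⇒allB _ (allVertices n) (λ x _ → ≡-beq (r x))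

  MapsTo-⊙ : ∀ a b {S T U} → MapsTo a S T → MapsTo b T U → MapsTo (b ⊙ a) S U
  MapsTo-⊙ a b {S} {T} {U} r s x = trans (cong U (actV-⊙ b a x)) (trans (s (actV a x)) (r x))

  MapsTo-inv : ∀ a {S T} → IsSignedPerm a → MapsTo a S T → MapsTo (invS a) T S
  MapsTo-inv a {S} {T} sa r y = trans (sym (r (actV (invS a) y))) (cong T (actV-invʳ a sa y))

  MapsTo⇒B-Equiv : ∀ a {S T} → IsSignedPerm a → MapsTo a S T → B-Equiv S T
  MapsTo⇒B-Equiv a {S} {T} sa r = a , sa , λ y →
    (λ e → actV (invS a) y , trans (sym (r (actV (invS a) y))) (trans (cong T (actV-invʳ a sa y)) e) , actV-invʳ a sa y) ,
    (λ { (x , Sx , refl) → trans (r x) Sx })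

  B-Equiv⇒MapsTo : ∀ {S T} → (be : B-Equiv S T) → MapsTo (proj₁ be) S T
  B-Equiv⇒MapsTo {S} {T} (a , sa , h) x with S x in e
  ... | true = proj₂ (h (actV a x)) (x , e , refl)
  ... | false with T (actV a x) in e'
  ...   | false = refl
  ...   | true with proj₁ (h (actV a x)) e'
  ...     | x' , Sx' , ax'≡ax = ⊥-elim (true≢false (trans (sym Sx') (trans (cong S (actV-injective a sa ax'≡ax)) e)))

  InF-⊙ : ∀ (H : Hyp n) a b → InF H a → InF H b → InF H (a ⊙ b)
  InF-⊙ H a b (sa , fa) (sb , fb) = ⊙-signed a b sa sb , λ x →
    (λ p → subst (OnH H) (sym (actℚ-⊙ a b x)) (proj₁ (fa (actℚ b x)) (proj₁ (fb x) p))) ,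
    (λ p → proj₂ (fb x) (proj₂ (fa (actℚ b x)) (subst (OnH H) (actℚ-⊙ a b x) p)))

  InF-invS : ∀ (H : Hyp n) a → InF H a → InF H (invS a)
  InF-invS H a (sa , fa) = invS-signed a sa , λ x →
    (λ p → proj₂ (fa (actℚ (invS a) x)) (subst (OnH H) (sym (actℚ-invʳ a sa x)) p)) ,
    (λ p → subst (OnH H) (actℚ-invʳ a sa x) (proj₁ (fa (actℚ (invS a) x)) p))

  InF-onHᵇ : ∀ (H : Hyp n) g → InF H g → ∀ v → onHᵇ H (actV g v) ≡ onHᵇ H v
  InF-onHᵇ H g (_ , fg) v = does-⇔ (λ p → proj₂ (fg (emb v)) (subst (OnH H) (emb-act g v) p))
                                    (λ p → subst (OnH H) (sym (emb-act g v)) (proj₁ (fg (emb v)) p))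
                                    (dot (coef H) (emb (actV g v)) QP.≟ rhs H) (dot (coef H) (emb v) QP.≟ rhs H)

  ⊙-cancelʳ : ∀ (w₀ : SPerm n) → IsSignedPerm w₀ → ∀ h → (h ⊙ w₀) ⊙ invS w₀ ≡ h
  ⊙-cancelʳ w₀ s₀ h = trans (⊙-assoc h w₀ (invS w₀)) (trans (cong (h ⊙_) (⊙-invʳ w₀ s₀)) (⊙-idʳ h))

  translate-↭ : ∀ (H : Hyp n) (Fl : List (SPerm n)) → Unique Fl → (∀ w → w ∈ Fl ⇔ InF H w) →
                ∀ w₀ → InF H w₀ → map (_⊙ w₀) Fl ↭ Fl
  translate-↭ H Fl uFl Fl-spec w₀ w₀∈F = ∼bag⇒↭ (unique∧set⇒bag (UP.map⁺ cancel uFl) uFl (mk⇔ to from))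
    where
    s₀ : IsSignedPerm w₀
    s₀ = proj₁ w₀∈F
    cancel : ∀ {h₁ h₂} → h₁ ⊙ w₀ ≡ h₂ ⊙ w₀ → h₁ ≡ h₂
    cancel {h₁} {h₂} e = trans (sym (⊙-cancelʳ w₀ s₀ h₁)) (trans (cong (_⊙ invS w₀) e) (⊙-cancelʳ w₀ s₀ h₂))
    to : ∀ {f} → f ∈ map (_⊙ w₀) Fl → f ∈ Fl
    to m with MP.∈-map⁻ (_⊙ w₀) m
    ... | h , h∈Fl , refl = Equivalence.from (Fl-spec (h ⊙ w₀)) (InF-⊙ H h w₀ (Equivalence.to (Fl-spec h) h∈Fl) w₀∈F)
    from : ∀ {f} → f ∈ Fl → f ∈ map (_⊙ w₀) Fl
    from {f} m = subst (_∈ map (_⊙ w₀) Fl) (trans (⊙-assoc f (invS w₀) w₀) (trans (cong (f ⊙_) (⊙-invˡ w₀ s₀)) (⊙-idʳ f)))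
      (MP.∈-map⁺ (_⊙ w₀) (Equivalence.from (Fl-spec (f ⊙ invS w₀)) (InF-⊙ H f (invS w₀) (Equivalence.to (Fl-spec f) m) (InF-invS H w₀ w₀∈F))))

sizes-complement : ∀ I c c' k m → c + c' ≡ m → ⟦ I ∧ ((c ≡ᵇ k) ∧ (c' ≡ᵇ m ∸ k)) ⟧ ≡ ⟦ c ≡ᵇ k ⟧ * ⟦ I ⟧
sizes-complement I c c' k m e with c ≡ᵇ k in q
... | false rewrite BP.∧-zeroʳ I = refl
... | true with ≡ᵇ-≡ {c} {k} q
...   | refl rewrite trans (cong (c' ≡ᵇ_) (trans (cong (_∸ c) (sym e)) (NP.m+n∸m≡n c c'))) (≡ᵇ-refl c') | BP.∧-identityʳ I =
  sym (NP.+-identityʳ _)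

allPairs-split : ∀ {a p} {A : Set a} {P : A → A → Set p} xs y ys → AllPairs P (xs ++ y ∷ ys) → (∀ x → x ∈ xs → P x y) × All (P y) ys
allPairs-split [] y ys (py ∷ _) = (λ x ()) , py
allPairs-split (x ∷ xs) y ys (px ∷ rest) =
  (λ { x' (here refl) → All.lookup px (MP.∈-++⁺ʳ xs (here refl)) ; x' (there m) → proj₁ (allPairs-split xs y ys rest) x' m }) ,
  proj₂ (allPairs-split xs y ys rest)

module Burnside {n} (H : Hyp n) (k : ℕ) (Fl : List (SPerm n)) (uFl : Unique Fl)
                (Fl-spec : ∀ w → w ∈ Fl ⇔ InF H w) where

  VHl : List (Vertex n)
  VHl = VH H

  m : ℕ
  m = length VHl

  inF : ∀ {w} → w ∈ Fl → InF H w
  inF {w} = Equivalence.to (Fl-spec w)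

  VH-on : ∀ {v} → v ∈ VHl → onHᵇ H v ≡ true
  VH-on m = proj₂ (MP.∈-filter⁻ (λ v → onHᵇ H v BP.≟ true) {xs = allVertices n} m)

  on-VH : ∀ {v} → onHᵇ H v ≡ true → v ∈ VHl
  on-VH {v} e = MP.∈-filter⁺ (λ v → onHᵇ H v BP.≟ true) (allVertices-complete v) e

  VH-unique : Unique VHl
  VH-unique = UP.filter⁺ (λ v → onHᵇ H v BP.≟ true) (allVertices-unique n)

  VH-closed : ∀ g → InF H g → ∀ y → y ∈ VHl → actV g y ∈ VHl
  VH-closed g g∈F y m = on-VH (trans (InF-onHᵇ H g g∈F y) (VH-on m))

  InH : Sub n → Set
  InH τ = ∀ v → τ v ≡ true → onHᵇ H v ≡ true

  supported⇒InH : ∀ τ → SupportedIn VHl τ → InH τ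
  supported⇒InH τ s v e with onHᵇ H v in q
  ... | true = refl
  ... | false = ⊥-elim (true≢false (trans (sym e) (s v (λ v∈ → true≢false (trans (sym (VH-on v∈)) q)))))

  InH-off : ∀ τ → InH τ → ∀ v → onHᵇ H v ≡ false → τ v ≡ false
  InH-off τ h v e with τ v in q
  ... | false = refl
  ... | true = ⊥-elim (true≢false (trans (sym (h v q)) e))

  card-InH : ∀ τ → InH τ → card τ ≡ count τ VHl
  card-InH τ h = trans (length-filter τ (allVertices n)) (count-filter τ (onHᵇ H) (allVertices n) h)

  fixedK : SPerm n → Sub n → ℕ
  fixedK g σ = ⟦ card σ ≡ᵇ k ⟧ * ⟦ mapsToᵇ g σ σ ⟧

  imageK : Sub n → SPerm n → Sub n → ℕ
  imageK R h σ = ⟦ card σ ≡ᵇ k ⟧ * ⟦ mapsToᵇ h R σ ⟧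

  cycleMonomial-fixed : ∀ g → g ∈ Fl → cycleMonomial H g k (m ∸ k) ≡ sumSubsets VHl (fixedK g)
  cycleMonomial-fixed g g∈Fl = begin
    cycleMonomial H g k (m ∸ k)
      ≡⟨ prodFrom1-zProduct m (cycles H g) k (m ∸ k) ⟩
    zProduct (cycleType m (cycles H g)) k (m ∸ k)
      ≡⟨ cong (λ l → zProduct l k (m ∸ k)) (cycleType-cong m (cycles H g) (P.cyclesIn VHl) cycles≡) ⟩
    zProduct (cycleType m (P.cyclesIn VHl)) k (m ∸ k)
      ≡⟨ sym (P.polya m VHl NP.≤-refl NP.≤-refl VH-unique (VH-closed g g∈F) k (m ∸ k)) ⟩
    sumSubsets VHl (P.invariantWith VHl k (m ∸ k))
      ≡⟨ sumSubsets-cong VHl _ _ invariant≡fixed ⟩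
    sumSubsets VHl (fixedK g) ∎
    where
    open ≡-Reasoning
    g∈F = inF g∈Fl
    module P = Polya g (proj₁ g∈F) m
    cycles≡ : ∀ i → 1 ≤ i → i ≤ m → cycles H g i ≡ P.cyclesIn VHl i
    cycles≡ (suc j) _ _ = cong (_/ suc j) (length-filter (cycleLenIs g (suc j)) VHl)
    -- off H both τ (g x) and τ x vanish, so invariance need only be tested on V_n(H)
    invariant≡fixed : ∀ τ → SupportedIn VHl τ → P.invariantWith VHl k (m ∸ k) τ ≡ fixedK g τ
    invariant≡fixed τ s = trans (sizes-complement _ (count τ VHl) (count (λ v → not (τ v)) VHl) k m (count+count-not τ VHl))
      (cong₂ (λ c r → ⟦ c ≡ᵇ k ⟧ * ⟦ r ⟧) (sym (card-InH τ inH))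
        (sym (allB-filter (λ x → beq (τ (actV g x)) (τ x)) (onHᵇ H) (allVertices n)
           (λ x off → ≡-beq (trans (InH-off τ inH (actV g x) (trans (InF-onHᵇ H g g∈F x) off)) (sym (InH-off τ inH x off)))))))
      where
      inH = supported⇒InH τ s

  images-unique : ∀ R → KPolyInH H k R → ∀ h → h ∈ Fl → sumSubsets VHl (imageK R h) ≡ 1
  images-unique R R-in h h∈Fl =
    trans (sumSubsets-cong VHl (imageK R h) (λ τ → ⟦ agreesOn VHl τ hR ⟧ * 1) pointwise)
          (sumOver-pin VHl hR (λ _ → 1) VH-unique (λ _ _ _ _ → refl) (λ _ → false))
    where
    h∈F = inF h∈Fl
    sh = proj₁ h∈F
    hR : Sub n
    hR y = R (actV (invS h) y)
    R-InH : InH R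
    R-InH v e = Equivalence.to BP.T-≡ (proj₁ R-in v e)
    MapsTo⇒≡hR : ∀ τ → MapsTo h R τ → ∀ y → τ y ≡ hR y
    MapsTo⇒≡hR τ r y = trans (cong τ (sym (actV-invʳ h sh y))) (r (actV (invS h) y))
    card-hR : card hR ≡ k
    card-hR = trans (length-filter hR (allVertices n))
      (trans (sym (sumL-map (λ v → ⟦ R v ⟧) (actV (invS h)) (allVertices n)))
      (trans (sumL-↭ (λ v → ⟦ R v ⟧) (allVertices-permuted (invS h) (invS-signed h sh)))
             (trans (sym (length-filter R (allVertices n))) (proj₂ R-in))))
    mapsTo≡agrees : ∀ τ → SupportedIn VHl τ → mapsToᵇ h R τ ≡ agreesOn VHl τ hR
    mapsTo≡agrees τ s = bool-ext to from
      where
      to : mapsToᵇ h R τ ≡ true → agreesOn VHl τ hR ≡ true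
      to e = ⇒allB _ VHl (λ y _ → ≡-beq (MapsTo⇒≡hR τ (mapsToᵇ⇒ h R τ e) y))
      from : agreesOn VHl τ hR ≡ true → mapsToᵇ h R τ ≡ true
      from e = ⇒mapsToᵇ h R τ λ x → byPosition x (onHᵇ H (actV h x)) refl
        where
        byPosition : ∀ x b → onHᵇ H (actV h x) ≡ b → τ (actV h x) ≡ R x
        byPosition x true q = trans (beq-≡ (allB⇒ _ VHl e (actV h x) (on-VH q))) (cong R (actV-invˡ h sh x))
        byPosition x false q = trans (InH-off τ (supported⇒InH τ s) (actV h x) q)
                                     (sym (InH-off R R-InH x (trans (sym (InF-onHᵇ H h h∈F x)) q)))
    pointwise : ∀ τ → SupportedIn VHl τ → imageK R h τ ≡ ⟦ agreesOn VHl τ hR ⟧ * 1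
    pointwise τ s with mapsToᵇ h R τ in e
    ... | false rewrite sym (trans (sym e) (mapsTo≡agrees τ s)) = NP.*-zeroʳ ⟦ card τ ≡ᵇ k ⟧
    ... | true rewrite sym (trans (sym e) (mapsTo≡agrees τ s))
                    | trans (cong (_≡ᵇ k) (trans (length-filter τ (allVertices n))
                              (trans (count-cong (allVertices n) (MapsTo⇒≡hR τ (mapsToᵇ⇒ h R τ e))) (sym (length-filter hR (allVertices n))))))
                            (trans (cong (_≡ᵇ k) card-hR) (≡ᵇ-refl k)) = refl

  module Classes (L : List (Sub n)) (L-in : All (KPolyInH H k) L)
                 (L-distinct : AllPairs (λ S S' → ¬ B-Equiv S S') L)
                 (L-covers : (S : Sub n) → KPolyInH H k S → Σ (Sub n) λ S' → S' ∈ L × B-Equiv S S')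
                 (H≢0 : IsHyperplane H) (big : 2 ^ n < 4 * k) where

    -- For a k-subset σ of V_n(H), the pairs (R , h) with h R = σ correspond to the
    -- g ∈ F(H) fixing σ: σ is equivalent to exactly one R₀ ∈ L, via some w₀ which
    -- lies in F(H) because σ has more than 2^(n-2) vertices; then h ↦ h ⊙ w₀.
    pairs≡stabiliser : ∀ σ → InH σ → card σ ≡ k →
      sumL (λ R → sumL (λ h → ⟦ mapsToᵇ h R σ ⟧) Fl) L ≡ sumL (λ g → ⟦ mapsToᵇ g σ σ ⟧) Fl
    pairs≡stabiliser σ σ-InH |σ|≡k = begin
      sumL pairsWith L
        ≡⟨ cong (sumL pairsWith) L≡ ⟩
      sumL pairsWith (L₁ ++ R₀ ∷ L₂)
        ≡⟨ sumL-++ pairsWith L₁ (R₀ ∷ L₂) ⟩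
      sumL pairsWith L₁ + (pairsWith R₀ + sumL pairsWith L₂)
        ≡⟨ cong₂ (λ a b → a + (pairsWith R₀ + b)) (sumL-zero L₁ before) (sumL-zero L₂ after) ⟩
      0 + (pairsWith R₀ + 0)
        ≡⟨ NP.+-identityʳ (pairsWith R₀) ⟩
      pairsWith R₀
        ≡⟨ sumL-cong Fl (λ h _ → cong ⟦_⟧ (translate h)) ⟩
      sumL (λ h → ⟦ mapsToᵇ (h ⊙ w₀) σ σ ⟧) Fl
        ≡⟨ sym (sumL-map (λ g → ⟦ mapsToᵇ g σ σ ⟧) (_⊙ w₀) Fl) ⟩
      sumL (λ g → ⟦ mapsToᵇ g σ σ ⟧) (map (_⊙ w₀) Fl)
        ≡⟨ sumL-↭ (λ g → ⟦ mapsToᵇ g σ σ ⟧) (translate-↭ H Fl uFl Fl-spec w₀ w₀∈F) ⟩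
      sumL (λ g → ⟦ mapsToᵇ g σ σ ⟧) Fl ∎
      where
      open ≡-Reasoning
      pairsWith : Sub n → ℕ
      pairsWith R = sumL (λ h → ⟦ mapsToᵇ h R σ ⟧) Fl
      covered = L-covers σ ((λ v e → Equivalence.from BP.T-≡ (σ-InH v e)) , |σ|≡k)
      R₀ = proj₁ covered
      R₀∈L = proj₁ (proj₂ covered)
      σ~R₀ = proj₂ (proj₂ covered)
      w₀ = proj₁ σ~R₀
      s₀ : IsSignedPerm w₀
      s₀ = proj₁ (proj₂ σ~R₀)
      w₀σ≡R₀ : MapsTo w₀ σ R₀
      w₀σ≡R₀ = B-Equiv⇒MapsTo σ~R₀
      w₀∈F : InF H w₀
      w₀∈F = s₀ , stabilises H H≢0 w₀ s₀ σ (subst (λ z → 2 ^ n < 4 * z) (sym (trans (sym (length-filter σ (allVertices n))) |σ|≡k)) big)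
        (λ x e → σ-InH x e , Equivalence.to BP.T-≡ (proj₁ (All.lookup L-in R₀∈L) (actV w₀ x) (trans (w₀σ≡R₀ x) e)))
      split = MP.∈-∃++ R₀∈L
      L₁ = proj₁ split
      L₂ = proj₁ (proj₂ split)
      L≡ : L ≡ L₁ ++ R₀ ∷ L₂
      L≡ = proj₂ (proj₂ split)
      distinct = allPairs-split L₁ R₀ L₂ (subst (AllPairs (λ S S' → ¬ B-Equiv S S')) L≡ L-distinct)
      none : ∀ h R → (MapsTo h R σ → ⊥) → ⟦ mapsToᵇ h R σ ⟧ ≡ 0
      none h R ¬r with mapsToᵇ h R σ in e
      ... | false = refl
      ... | true = ⊥-elim (¬r (mapsToᵇ⇒ h R σ e))
      -- a class listed before R₀ would be equivalent to R₀
      before : ∀ R → R ∈ L₁ → pairsWith R ≡ 0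
      before R m = sumL-zero Fl (λ h h∈Fl → none h R λ hR≡σ →
        proj₁ distinct R m (MapsTo⇒B-Equiv (w₀ ⊙ h) (⊙-signed w₀ h s₀ (proj₁ (inF h∈Fl))) (MapsTo-⊙ h w₀ {R} {σ} {R₀} hR≡σ w₀σ≡R₀)))
      after : ∀ R → R ∈ L₂ → pairsWith R ≡ 0
      after R m = sumL-zero Fl (λ h h∈Fl → none h R λ hR≡σ →
        All.lookup (proj₂ distinct) m (MapsTo⇒B-Equiv (invS h ⊙ invS w₀)
          (⊙-signed (invS h) (invS w₀) (invS-signed h (proj₁ (inF h∈Fl))) (invS-signed w₀ s₀))
          (MapsTo-⊙ (invS w₀) (invS h) {R₀} {σ} {R} (MapsTo-inv w₀ {σ} {R₀} s₀ w₀σ≡R₀) (MapsTo-inv h {R} {σ} (proj₁ (inF h∈Fl)) hR≡σ))))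
      translate : ∀ h → mapsToᵇ h R₀ σ ≡ mapsToᵇ (h ⊙ w₀) σ σ
      translate h = bool-ext
        (λ e → ⇒mapsToᵇ (h ⊙ w₀) σ σ (MapsTo-⊙ w₀ h {σ} {R₀} {σ} w₀σ≡R₀ (mapsToᵇ⇒ h R₀ σ e)))
        (λ e → ⇒mapsToᵇ h R₀ σ (subst (λ z → MapsTo z R₀ σ) (⊙-cancelʳ w₀ s₀ h)
          (MapsTo-⊙ (invS w₀) (h ⊙ w₀) {R₀} {σ} {σ} (MapsTo-inv w₀ {σ} {R₀} s₀ w₀σ≡R₀) (mapsToᵇ⇒ (h ⊙ w₀) σ σ e))))

    burnside : length L * length Fl ≡ scaledCoeffC H Fl k (m ∸ k)
    burnside = sym (begin
      sumL (λ g → cycleMonomial H g k (m ∸ k)) Fl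
        ≡⟨ sumL-cong Fl cycleMonomial-fixed ⟩
      sumL (λ g → sumSubsets VHl (fixedK g)) Fl
        ≡⟨ sym (sumOver-sumL VHl fixedK Fl ∅) ⟩
      sumSubsets VHl (λ σ → sumL (λ g → fixedK g σ) Fl)
        ≡⟨ sumSubsets-cong VHl _ _ (λ σ s → regroup σ (supported⇒InH σ s)) ⟩
      sumSubsets VHl (λ σ → sumL (λ R → sumL (λ h → imageK R h σ) Fl) L)
        ≡⟨ sumOver-sumL VHl (λ R σ → sumL (λ h → imageK R h σ) Fl) L ∅ ⟩
      sumL (λ R → sumSubsets VHl (λ σ → sumL (λ h → imageK R h σ) Fl)) L
        ≡⟨ sumL-cong L (λ R _ → sumOver-sumL VHl (imageK R) Fl ∅) ⟩
      sumL (λ R → sumL (λ h → sumSubsets VHl (imageK R h)) Fl) L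
        ≡⟨ sumL-cong L (λ R R∈L → sumL-cong Fl (λ h h∈Fl → images-unique R (All.lookup L-in R∈L) h h∈Fl)) ⟩
      sumL (λ R → sumL (λ h → 1) Fl) L
        ≡⟨ sumL-cong L (λ R _ → trans (sumL-const 1 Fl) (NP.*-identityʳ (length Fl))) ⟩
      sumL (λ R → length Fl) L
        ≡⟨ sumL-const (length Fl) L ⟩
      length L * length Fl ∎)
      where
      open ≡-Reasoning
      ∅ : Sub n
      ∅ = λ _ → false
      regroup : ∀ σ → InH σ → sumL (λ g → fixedK g σ) Fl ≡ sumL (λ R → sumL (λ h → imageK R h σ) Fl) L
      regroup σ σ-InH = trans (sumL-*ˡ c (λ g → ⟦ mapsToᵇ g σ σ ⟧) Fl)
        (trans (bySize (card σ ≡ᵇ k) refl)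
          (sym (trans (sumL-cong L (λ R _ → sumL-*ˡ c (λ h → ⟦ mapsToᵇ h R σ ⟧) Fl))
                      (sumL-*ˡ c (λ R → sumL (λ h → ⟦ mapsToᵇ h R σ ⟧) Fl) L))))
        where
        c = ⟦ card σ ≡ᵇ k ⟧
        bySize : ∀ b → (card σ ≡ᵇ k) ≡ b →
                 c * sumL (λ g → ⟦ mapsToᵇ g σ σ ⟧) Fl ≡ c * sumL (λ R → sumL (λ h → ⟦ mapsToᵇ h R σ ⟧) Fl) L
        bySize false e rewrite e = refl
        bySize true e = cong (c *_) (sym (pairs≡stabiliser σ σ-InH (≡ᵇ-≡ e)))


more-than-quarter : ∀ n k → 2 ≤ n → 2 ^ (n ∸ 2) < k → 2 ^ n < 4 * k
more-than-quarter (suc zero) k (s≤s ()) lt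
more-than-quarter (suc (suc n')) k _ lt = subst (_< 4 * k) (NP.*-assoc 2 2 (2 ^ n')) (NP.*-monoʳ-< 4 lt)

-- Only 2^(n-2) < k and the fact that H is a genuine hyperplane are used: the former makes
-- B_n-equivalence of k-subsets of V_n(H) coincide with F(H)-equivalence, and then
-- Burnside and Pólya give the coefficient.
theorem4p2 : (n k : ℕ) → 2 ≤ n → 2 ^ (n ∸ 2) < k → k ≤ 2 ^ (n ∸ 1) →
    (H : Hyp n) → Spanned H → k ≤ length (VH H) →
    (Fl : List (SPerm n)) → Unique Fl → ((w : SPerm n) → (w ∈ Fl ⇔ InF H w)) →
    (L : List (Sub n)) →
    All (KPolyInH H k) L →
    AllPairs (λ S S' → ¬ B-Equiv S S') L →
    ((S : Sub n) → KPolyInH H k S → Σ (Sub n) λ S' → S' ∈ L × B-Equiv S S') →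
    length L * length Fl ≡ scaledCoeffC H Fl k (length (VH H) ∸ k)
theorem4p2 n k 2≤n lower _ H spanned _ Fl uFl Fl-spec L L-in L-distinct L-covers =
  burnside L L-in L-distinct L-covers H≢0 (more-than-quarter n k 2≤n lower)
  where
  open Burnside H k Fl uFl Fl-spec
  open Classes using (burnside)
  H≢0 : IsHyperplane H
  H≢0 = proj₁ spanned
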